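{- Let the 3-pan be the graph on vertices $e_1,e_2,e_3,e_4$ with edges $e_1e_2$, $e_2e_3$, $e_2e_4$, $e_3e_4$. Let $H$ be the $(e_2,2)$-ordering of the 3-pan. Then $R_<(H)\le 10$.
   Context: A $k$-ordering of a graph $H$ assigns distinct order-labels from $\{1,\ldots,|H|\}$ to $k$ of the vertices of $H$. For a vertex $v$ of $H$ and $1\le l\le |H|$, the $(v,l)$-ordering of $H$ is the 1-ordering in which $v$ receives order-label $l$ and no other vertex is labeled. An ordered 2-coloring on $n$ vertices is a red/blue coloring of the edges of the complete graph on vertex set $\{1,\ldots,n\}$. It contains a $k$-ordering $H$ (in a given color) if it has a subgraph isomorphic to $H$, all of whose edges have that color, such that for every $i$ the $i$-th smallest vertex of the copy corresponds to a vertex of $H$ that has order-label $i$ or no order-label. $R_<(H)$ is the least $n$ such that every ordered 2-coloring on $n$ vertices contains a monochromatic (red or blue) copy of $H$. -}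

module Defs where

open import Data.Nat using (ℕ; zero; suc; _≤_)
open import Data.Fin using (Fin; zero; suc; toℕ; _<_; _<?_)
open import Data.Fin.Properties using ()
open import Data.List using (length; filter; allFin)
open import Data.Maybe using (Maybe; just; nothing)
open import Data.Product using (Σ; _×_; ∃)
open import Data.Sum using (_⊎_)
open import Function.Definitions using (Injective)
open import Relation.Binary.PropositionalEquality using (_≡_)
open import Relation.Nullary using (¬_)

record Graph : Set₁ where
  field
    size   : ℕ
    Adj    : Fin size → Fin size → Set
    adj-sym : ∀ {u v} → Adj u v → Adj v u
    irrefl : ∀ {u} → ¬ Adj u u

open Graph public

-- A (partially) ordered graph: a graph plus order-labels.
-- label v = just l  means v has order-label (toℕ l + 1) ∈ {1,…,|H|};
-- label v = nothing means v is unlabelled. Labels are distinct.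
record OrderedGraph : Set₁ where
  field
    graph    : Graph
    label    : Fin (size graph) → Maybe (Fin (size graph))
    distinct : ∀ {u v l} → label u ≡ just l → label v ≡ just l → u ≡ v

open OrderedGraph public

vl-ordering : (G : Graph) → Fin (size G) → Fin (size G) → OrderedGraph
vl-ordering G v l = record { graph = G ; label = lab ; distinct = dist }
  where
  open import Data.Fin.Properties using (_≟_)
  open import Relation.Nullary using (yes; no)
  open import Relation.Binary.PropositionalEquality using (refl; trans; sym)
  lab : Fin (size G) → Maybe (Fin (size G))
  lab w with w ≟ v
  ... | yes _ = just l
  ... | no  _ = nothing
  dist : ∀ {u w l'} → lab u ≡ just l' → lab w ≡ just l' → u ≡ w
  dist {u} {w} p q with u ≟ v | w ≟ v
  ... | yes a | yes b = trans a (sym b)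
  dist () q | no _ | _
  dist p () | yes _ | no _

data Colour : Set where
  red blue : Colour

OrderedColouring : ℕ → Set
OrderedColouring n = (i j : Fin n) → i < j → Colour

rankBelow : ∀ {m n} → (Fin m → Fin n) → Fin m → ℕ
rankBelow {m} φ v = length (filter (λ w → φ w <? φ v) (allFin m))

Contains : ∀ {n} → OrderedColouring n → OrderedGraph → Colour → Set
Contains {n} χ H c =
  Σ (Fin (size (graph H)) → Fin n) λ φ →
    Injective _≡_ _≡_ φ
    × (∀ u v → Adj (graph H) u v → (p : φ u < φ v) → χ (φ u) (φ v) p ≡ c)
    × (∀ v l → label H v ≡ just l → rankBelow φ v ≡ toℕ l)

Arrows : ℕ → OrderedGraph → Set
Arrows n H = (χ : OrderedColouring n) → Contains χ H red ⊎ Contains χ H blue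

IsOrderedRamseyNumber : OrderedGraph → ℕ → Set
IsOrderedRamseyNumber H r = Arrows r H × (∀ n → Arrows n H → r ≤ n)

-- The 3-pan: vertices e1,e2,e3,e4 = 0,1,2,3; edges e1e2, e2e3, e2e4, e3e4.
data PanEdge : Fin 4 → Fin 4 → Set where
  e12 : PanEdge zero (suc zero)
  e21 : PanEdge (suc zero) zero
  e23 : PanEdge (suc zero) (suc (suc zero))
  e32 : PanEdge (suc (suc zero)) (suc zero)
  e24 : PanEdge (suc zero) (suc (suc (suc zero)))
  e42 : PanEdge (suc (suc (suc zero))) (suc zero)
  e34 : PanEdge (suc (suc zero)) (suc (suc (suc zero)))
  e43 : PanEdge (suc (suc (suc zero))) (suc (suc zero))

pan-sym : ∀ {u v} → PanEdge u v → PanEdge v u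
pan-sym e12 = e21
pan-sym e21 = e12
pan-sym e23 = e32
pan-sym e32 = e23
pan-sym e24 = e42
pan-sym e42 = e24
pan-sym e34 = e43
pan-sym e43 = e34

pan-irrefl : ∀ {u} → ¬ PanEdge u u
pan-irrefl ()

3-pan : Graph
3-pan = record { size = 4 ; Adj = PanEdge ; adj-sym = pan-sym ; irrefl = pan-irrefl }

-- e2 = vertex 1; order-label 2 = Fin index 1 (0-indexed).
e₂ : Fin 4
e₂ = suc zero

label2 : Fin 4
label2 = suc zero

module Submission where

-- In fact R_<(H) = 9. A copy of H is determined by the images a, b, c, d of e₁, e₂, e₃, e₄:
-- they must be distinct, b must be the second smallest of them, and the pairs ab, bc, bd, cd
-- must share a colour. The colouring χ₈ of K₈ below has no such quadruple, which is checked
-- exhaustively. For K₉ the check is done once for all colourings by a decision tree that queries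
-- pair colours until the answers force a monochromatic quadruple. Since the arrow property is
-- inherited by larger complete graphs, 9 is the least n with n → H.

open import Defs
open import Data.Nat as ℕ using (ℕ; _≤_)
open import Data.Nat.Properties using (≰⇒>; ≤-pred; n≤1+n)
open import Data.Fin using (Fin; zero; suc; #_; toℕ; inject≤; _<_)
open import Data.Fin.Properties as Fin
  using (_<?_; all?; toℕ-inject≤; inject≤-injective; <-irrelevant; <-cmp; <-asym)
open import Data.Maybe using (just)
open import Data.Unit using (tt)
open import Data.List using (List; []; _∷_; length; allFin)
open import Data.List.Properties using (filter-≐)
open import Data.List.Relation.Unary.All as All using (All; []; _∷_)
open import Data.List.Membership.Propositional using (_∈_)
import Data.List.Membership.DecPropositional as DecMembership
open import Data.Product using (∃; ∃-syntax; _×_; _,_)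
import Data.Product.Properties as Product
open import Data.Sum as Sum using (_⊎_; inj₁; inj₂)
open import Data.Vec using ([]; _∷_) renaming (lookup to _!_)
open import Function using (_∘_)
open import Function.Definitions using (Injective)
open import Relation.Binary.Definitions using (DecidableEquality; tri<; tri≈; tri>)
open import Relation.Binary.PropositionalEquality
  using (_≡_; refl; sym; trans; cong; subst; subst₂)
open import Relation.Nullary
  using (¬_; Dec; yes; no; map′; _×-dec_; _⊎-dec_; _→-dec_; ¬?; contradiction)
open import Relation.Nullary.Decidable using (toWitness)

H : OrderedGraph
H = vl-ordering 3-pan e₂ label2

_≟ᶜ_ : DecidableEquality Colour
red  ≟ᶜ red  = yes refl
blue ≟ᶜ blue = yes refl
red  ≟ᶜ blue = no λ ()
blue ≟ᶜ red  = no λ ()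

module _ {n : ℕ} (χ : OrderedColouring n) where

  -- The colour of the unordered pair {x, y}; the value on the diagonal is junk.
  colour : Fin n → Fin n → Colour
  colour x y with x <? y | y <? x
  ... | yes x<y | _       = χ x y x<y
  ... | no _    | yes y<x = χ y x y<x
  ... | no _    | no _    = red

  colour-< : ∀ {x y} (x<y : x < y) → colour x y ≡ χ x y x<y
  colour-< {x} {y} x<y with x <? y
  ... | yes x<y′ = cong (χ x y) (<-irrelevant x<y′ x<y)
  ... | no x≮y   = contradiction x<y x≮y

  colour-> : ∀ {x y} (x<y : x < y) → colour y x ≡ χ x y x<y
  colour-> {x} {y} x<y with y <? x | x <? y
  ... | yes y<x | _        = contradiction y<x (<-asym x<y)
  ... | no _    | yes x<y′ = cong (χ x y) (<-irrelevant x<y′ x<y)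
  ... | no _    | no x≮y   = contradiction x<y x≮y

  colour-sym : ∀ x y → colour x y ≡ colour y x
  colour-sym x y with <-cmp x y
  ... | tri< x<y _ _  = trans (colour-< x<y) (sym (colour-> x<y))
  ... | tri≈ _ refl _ = refl
  ... | tri> _ _ y<x  = trans (colour-> y<x) (sym (colour-< y<x))

  Coloured : Fin n → Fin n → Colour → Set
  Coloured x y k = colour x y ≡ k

rankBelow-resp : ∀ {m n n′} {φ : Fin m → Fin n} {ψ : Fin m → Fin n′} →
                 (∀ {x y} → φ x < φ y → ψ x < ψ y) → (∀ {x y} → ψ x < ψ y → φ x < φ y) →
                 ∀ v → rankBelow φ v ≡ rankBelow ψ v
rankBelow-resp {m} {φ = φ} {ψ} φ⇒ψ ψ⇒φ v =
  cong length (filter-≐ (λ w → φ w <? φ v) (λ w → ψ w <? ψ v) (φ⇒ψ , ψ⇒φ) (allFin m))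

injective? : ∀ {m n} (f : Fin m → Fin n) → Dec (Injective _≡_ _≡_ f)
injective? f = map′ (λ inj {x} {y} → inj x y) (λ inj x y → inj)
  (all? λ x → all? λ y → (f x Fin.≟ f y) →-dec (x Fin.≟ y))

module _ {n : ℕ} where

  pan : Fin n → Fin n → Fin n → Fin n → Fin 4 → Fin n
  pan a b c d = (a ∷ b ∷ c ∷ d ∷ []) !_

  Placed : Fin n → Fin n → Fin n → Fin n → Set
  Placed a b c d = Injective _≡_ _≡_ (pan a b c d) × rankBelow (pan a b c d) e₂ ≡ 1

  placed? : ∀ a b c d → Dec (Placed a b c d)
  placed? a b c d = injective? (pan a b c d) ×-dec (rankBelow (pan a b c d) e₂ ℕ.≟ 1)

  PanColoured : (Fin n → Fin n → Colour → Set) → Colour → Fin n → Fin n → Fin n → Fin n → Set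
  PanColoured R k a b c d = R a b k × R b c k × R b d k × R c d k

  panColoured? : ∀ {R} → (∀ x y k → Dec (R x y k)) → ∀ k a b c d → Dec (PanColoured R k a b c d)
  panColoured? R? k a b c d = R? a b k ×-dec R? b c k ×-dec R? b d k ×-dec R? c d k

  PanColoured-map : ∀ {R S k a b c d} → (∀ {x y} → R x y k → S x y k) →
                    PanColoured R k a b c d → PanColoured S k a b c d
  PanColoured-map f (ab , bc , bd , cd) = f ab , f bc , f bd , f cd

MonochromaticPan : ∀ {n} → OrderedColouring n → Colour → Fin n → Fin n → Fin n → Fin n → Set
MonochromaticPan χ k a b c d = PanColoured (Coloured χ) k a b c d × Placed a b c d

monochromaticPan? : ∀ {n} χ k (a b c d : Fin n) → Dec (MonochromaticPan χ k a b c d)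
monochromaticPan? χ k a b c d =
  panColoured? (λ x y k → colour χ x y ≟ᶜ k) k a b c d ×-dec placed? a b c d

module _ {n : ℕ} {χ : OrderedColouring n} {k : Colour} where

  pan⇒contains : ∀ {a b c d} → MonochromaticPan χ k a b c d → Contains χ H k
  pan⇒contains {a} {b} {c} {d} ((ab , bc , bd , cd) , inj , rank) =
    pan a b c d , inj , edges , labels
    where
    edge-colour : ∀ u v → PanEdge u v → colour χ (pan a b c d u) (pan a b c d v) ≡ k
    edge-colour _ _ e12 = ab
    edge-colour _ _ e21 = trans (colour-sym χ b a) ab
    edge-colour _ _ e23 = bc
    edge-colour _ _ e32 = trans (colour-sym χ c b) bc
    edge-colour _ _ e24 = bd
    edge-colour _ _ e42 = trans (colour-sym χ d b) bd
    edge-colour _ _ e34 = cd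
    edge-colour _ _ e43 = trans (colour-sym χ d c) cd

    edges : ∀ u v → PanEdge u v → (p : pan a b c d u < pan a b c d v) → χ _ _ p ≡ k
    edges u v e p = trans (sym (colour-< χ p)) (edge-colour u v e)

    labels : ∀ v l → label H v ≡ just l → rankBelow (pan a b c d) v ≡ toℕ l
    labels zero                   l ()
    labels (suc zero)             l refl = rank
    labels (suc (suc zero))       l ()
    labels (suc (suc (suc zero))) l ()

  contains⇒pan : Contains χ H k → ∃[ a ] ∃[ b ] ∃[ c ] ∃[ d ] MonochromaticPan χ k a b c d
  contains⇒pan (φ , inj , edges , labels) = φ (# 0) , φ (# 1) , φ (# 2) , φ (# 3) ,
    (edge-colour e12 , edge-colour e23 , edge-colour e24 , edge-colour e34) ,
    inj ∘ ψ-inj , trans (rankBelow-resp ψ⇒φ φ⇒ψ e₂) (labels e₂ label2 refl)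
    where
    ψ : Fin 4 → Fin n
    ψ = pan (φ (# 0)) (φ (# 1)) (φ (# 2)) (φ (# 3))

    ψ≗φ : ∀ u → ψ u ≡ φ u
    ψ≗φ zero                   = refl
    ψ≗φ (suc zero)             = refl
    ψ≗φ (suc (suc zero))       = refl
    ψ≗φ (suc (suc (suc zero))) = refl

    ψ-inj : ∀ {u v} → ψ u ≡ ψ v → φ u ≡ φ v
    ψ-inj {u} {v} e = trans (sym (ψ≗φ u)) (trans e (ψ≗φ v))

    ψ⇒φ : ∀ {u v} → ψ u < ψ v → φ u < φ v
    ψ⇒φ {u} {v} = subst₂ _<_ (ψ≗φ u) (ψ≗φ v)

    φ⇒ψ : ∀ {u v} → φ u < φ v → ψ u < ψ v
    φ⇒ψ {u} {v} = subst₂ _<_ (sym (ψ≗φ u)) (sym (ψ≗φ v))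

    edge-colour : ∀ {u v} → PanEdge u v → colour χ (φ u) (φ v) ≡ k
    edge-colour {u} {v} e with <-cmp (φ u) (φ v)
    ... | tri< p _ _ = trans (colour-< χ p) (edges u v e p)
    ... | tri≈ _ p _ = contradiction (subst (PanEdge u) (sym (inj p)) e) pan-irrefl
    ... | tri> _ _ q = trans (colour-> χ q) (edges v u (pan-sym e) q)

module _ {m n : ℕ} (m≤n : m ≤ n) where

  private
    ι : Fin m → Fin n
    ι i = inject≤ i m≤n

    ι-mono : ∀ {i j} → i < j → ι i < ι j
    ι-mono {i} {j} = subst₂ ℕ._<_ (sym (toℕ-inject≤ i m≤n)) (sym (toℕ-inject≤ j m≤n))

    ι-cancel : ∀ {i j} → ι i < ι j → i < j
    ι-cancel {i} {j} = subst₂ ℕ._<_ (toℕ-inject≤ i m≤n) (toℕ-inject≤ j m≤n)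

  restrict : OrderedColouring n → OrderedColouring m
  restrict χ i j i<j = χ (ι i) (ι j) (ι-mono i<j)

  contains-inject≤ : ∀ χ {G} c → Contains (restrict χ) G c → Contains χ G c
  contains-inject≤ χ c (φ , inj , edges , labels) = ι ∘ φ , ι-inj , edges′ , labels′
    where
    ι-inj : ∀ {u v} → ι (φ u) ≡ ι (φ v) → u ≡ v
    ι-inj = inj ∘ inject≤-injective m≤n m≤n _ _

    edges′ : ∀ u v → _ → (p : ι (φ u) < ι (φ v)) → χ _ _ p ≡ c
    edges′ u v e p = trans (cong (χ _ _) (<-irrelevant p _)) (edges u v e (ι-cancel p))

    labels′ : ∀ v l → _ → rankBelow (ι ∘ φ) v ≡ toℕ l
    labels′ v l eq = trans (rankBelow-resp ι-cancel ι-mono v) (labels v l eq)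

  arrows-mono : ∀ {G} → Arrows m G → Arrows n G
  arrows-mono {G} arrows χ =
    Sum.map (contains-inject≤ χ {G} red) (contains-inject≤ χ {G} blue) (arrows (restrict χ))

isOrderedRamseyNumber : ∀ {G r} → Arrows (ℕ.suc r) G → ¬ Arrows r G →
                        IsOrderedRamseyNumber G (ℕ.suc r)
isOrderedRamseyNumber {G} {r} arrows ¬arrows = arrows , minimal
  where
  minimal : ∀ n → Arrows n G → ℕ.suc r ≤ n
  minimal n arrowsₙ with ℕ.suc r ℕ.≤? n
  ... | yes r<n = r<n
  ... | no r≮n  = contradiction (arrows-mono (≤-pred (≰⇒> r≮n)) {G} arrowsₙ) ¬arrows

monochromaticPan-free? : ∀ {n} χ k → Dec (∀ (a b c d : Fin n) → ¬ MonochromaticPan χ k a b c d)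
monochromaticPan-free? χ k =
  all? λ a → all? λ b → all? λ c → all? λ d → ¬? (monochromaticPan? χ k a b c d)

χ₈ : OrderedColouring 8
χ₈ i j _ = colour₈ (toℕ i) (toℕ j)
  where
  colour₈ : ℕ → ℕ → Colour
  colour₈ 0 1 = red
  colour₈ 0 2 = red
  colour₈ 0 4 = red
  colour₈ 0 5 = red
  colour₈ 1 2 = red
  colour₈ 2 4 = red
  colour₈ 3 5 = red
  colour₈ 3 6 = red
  colour₈ 3 7 = red
  colour₈ 4 6 = red
  colour₈ 4 7 = red
  colour₈ 5 6 = red
  colour₈ _ _ = blue

χ₈-pan-free : ∀ k (a b c d : Fin 8) → ¬ MonochromaticPan χ₈ k a b c d
χ₈-pan-free red  = toWitness {a? = monochromaticPan-free? χ₈ red} tt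
χ₈-pan-free blue = toWitness {a? = monochromaticPan-free? χ₈ blue} tt

¬arrows₈ : ¬ Arrows 8 H
¬arrows₈ arrows = Sum.[ no-copy red , no-copy blue ] (arrows χ₈)
  where
  no-copy : ∀ k → ¬ Contains χ₈ H k
  no-copy k copy with contains⇒pan copy
  ... | a , b , c , d , monochromatic = χ₈-pan-free k a b c d monochromatic

Assignment : ℕ → Set
Assignment n = List (Fin n × Fin n × Colour)

Known : ∀ {n} → Assignment n → Fin n → Fin n → Colour → Set
Known as x y k = (x , y , k) ∈ as ⊎ (y , x , k) ∈ as

known? : ∀ {n} as (x y : Fin n) k → Dec (Known as x y k)
known? as x y k = ((x , y , k) ∈? as) ⊎-dec ((y , x , k) ∈? as)
  where open DecMembership (Product.≡-dec Fin._≟_ (Product.≡-dec Fin._≟_ _≟ᶜ_))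

Consistent : ∀ {n} → OrderedColouring n → Assignment n → Set
Consistent χ = All λ { (x , y , k) → Coloured χ x y k }

known⇒coloured : ∀ {n χ} {as : Assignment n} → Consistent χ as →
                 ∀ {x y k} → Known as x y k → Coloured χ x y k
known⇒coloured consistent (inj₁ xy∈as) = All.lookup consistent xy∈as
known⇒coloured {χ = χ} consistent {x} {y} (inj₂ yx∈as) =
  trans (colour-sym χ x y) (All.lookup consistent yx∈as)

-- A decision tree: node x y continues in one of two subtrees according to the colour of {x, y},
-- and leaf a b c d k claims that a, b, c, d are the images of e₁, …, e₄ in a copy of colour k.
data Certificate (n : ℕ) : Set where
  leaf : (a b c d : Fin n) → Colour → Certificate n
  node : (x y : Fin n) → (ifRed ifBlue : Certificate n) → Certificate n

Certifies : ∀ {n} → Assignment n → Certificate n → Set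
Certifies as (leaf a b c d k)        = PanColoured (Known as) k a b c d × Placed a b c d
Certifies as (node x y ifRed ifBlue) =
  Certifies ((x , y , red) ∷ as) ifRed × Certifies ((x , y , blue) ∷ as) ifBlue

certifies? : ∀ {n} as (t : Certificate n) → Dec (Certifies as t)
certifies? as (leaf a b c d k)        = panColoured? (known? as) k a b c d ×-dec placed? a b c d
certifies? as (node x y ifRed ifBlue) = certifies? _ ifRed ×-dec certifies? _ ifBlue

module _ {n : ℕ} (χ : OrderedColouring n) where

  monochromatic : ∀ k → Contains χ H k → Contains χ H red ⊎ Contains χ H blue
  monochromatic red  = inj₁
  monochromatic blue = inj₂

  certificate-sound : ∀ as (t : Certificate n) → Consistent χ as → Certifies as t →
                      Contains χ H red ⊎ Contains χ H blue
  certificate-sound as (leaf a b c d k) consistent (coloured , placed) =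
    monochromatic k (pan⇒contains (PanColoured-map {R = Known as} {S = Coloured χ}
                                    (known⇒coloured consistent) coloured , placed))
  certificate-sound as (node x y ifRed ifBlue) consistent (certRed , certBlue)
    with colour χ x y in xy
  ... | red  = certificate-sound _ ifRed  (xy ∷ consistent) certRed
  ... | blue = certificate-sound _ ifBlue (xy ∷ consistent) certBlue

certificate₉ : Certificate 9
certificate₉ =
  node #0 #1 (node #2 #3 (node #1 #2 (node #1 #3 (leaf #0 #1 #2 #3 red) (node #0 #2 (node #1 #4
  (leaf #4 #1 #0 #2 red) (node #1 #5 (leaf #5 #1 #0 #2 red) (node #3 #4 (node #3 #5 (node #4 #5
  (leaf #2 #3 #4 #5 red) (node #4 #6 (node #4 #7 (node #4 #8 (node #3 #6 (leaf #2 #3 #4 #6 red)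
  (node #3 #7 (leaf #2 #3 #4 #7 red) (node #6 #7 (leaf #3 #4 #6 #7 red) (leaf #1 #3 #6 #7 blue))))
  (leaf #8 #4 #1 #5 blue)) (leaf #7 #4 #1 #5 blue)) (leaf #6 #4 #1 #5 blue))) (node #3 #6
  (node #3 #7 (node #3 #8 (node #4 #6 (leaf #2 #3 #4 #6 red) (node #4 #7 (leaf #2 #3 #4 #7 red)
  (node #6 #7 (leaf #2 #3 #6 #7 red) (leaf #1 #4 #6 #7 blue)))) (leaf #8 #3 #1 #5 blue))
  (leaf #7 #3 #1 #5 blue)) (leaf #6 #3 #1 #5 blue))) (node #3 #5 (node #3 #6 (node #3 #7 (node #3 #8
  (node #5 #6 (leaf #2 #3 #5 #6 red) (node #5 #7 (leaf #2 #3 #5 #7 red) (node #6 #7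
  (leaf #2 #3 #6 #7 red) (leaf #1 #5 #6 #7 blue)))) (leaf #8 #3 #1 #4 blue)) (leaf #7 #3 #1 #4 blue))
  (leaf #6 #3 #1 #4 blue)) (leaf #5 #3 #1 #4 blue))))) (node #3 #4 (node #2 #4
  (leaf #1 #2 #3 #4 red) (node #2 #5 (node #2 #6 (node #2 #7 (node #3 #5 (leaf #1 #2 #3 #5 red)
  (node #3 #6 (leaf #1 #2 #3 #6 red) (node #5 #6 (leaf #1 #2 #5 #6 red) (leaf #1 #3 #5 #6 blue))))
  (node #2 #8 (node #4 #7 (node #0 #4 (node #0 #7 (node #3 #5 (leaf #1 #2 #3 #5 red) (node #3 #6
  (leaf #1 #2 #3 #6 red) (node #5 #6 (leaf #1 #2 #5 #6 red) (leaf #1 #3 #5 #6 blue))))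
  (leaf #4 #2 #0 #7 blue)) (leaf #7 #2 #0 #4 blue)) (leaf #0 #2 #4 #7 blue)) (node #4 #7 (node #4 #8
  (node #7 #8 (leaf #3 #4 #7 #8 red) (leaf #0 #2 #7 #8 blue)) (leaf #0 #2 #4 #8 blue))
  (leaf #0 #2 #4 #7 blue)))) (node #4 #6 (node #0 #4 (node #0 #6 (node #3 #5 (leaf #1 #2 #3 #5 red)
  (node #3 #6 (leaf #2 #3 #4 #6 red) (node #1 #5 (leaf #0 #1 #2 #5 red) (leaf #6 #3 #1 #5 blue))))
  (leaf #4 #2 #0 #6 blue)) (leaf #6 #2 #0 #4 blue)) (leaf #0 #2 #4 #6 blue))) (node #4 #5
  (node #0 #4 (node #0 #5 (node #3 #5 (leaf #2 #3 #4 #5 red) (node #1 #5 (leaf #2 #1 #0 #5 red)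
  (node #3 #6 (node #3 #7 (node #3 #8 (node #2 #6 (leaf #1 #2 #3 #6 red) (node #4 #6
  (leaf #2 #3 #4 #6 red) (leaf #0 #2 #4 #6 blue))) (leaf #8 #3 #1 #5 blue)) (leaf #7 #3 #1 #5 blue))
  (leaf #6 #3 #1 #5 blue)))) (leaf #4 #2 #0 #5 blue)) (leaf #5 #2 #0 #4 blue))
  (leaf #0 #2 #4 #5 blue)))) (node #1 #4 (node #2 #4 (leaf #0 #1 #2 #4 red) (node #0 #4
  (leaf #2 #1 #0 #4 red) (node #2 #5 (node #2 #6 (node #2 #7 (node #2 #8 (node #3 #5
  (leaf #1 #2 #3 #5 red) (node #1 #5 (leaf #0 #1 #2 #5 red) (leaf #4 #3 #1 #5 blue)))
  (leaf #8 #2 #0 #4 blue)) (leaf #7 #2 #0 #4 blue)) (leaf #6 #2 #0 #4 blue)) (leaf #5 #2 #0 #4 blue))))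
  (node #3 #5 (node #3 #6 (node #3 #7 (node #3 #8 (node #2 #5 (leaf #1 #2 #3 #5 red) (node #2 #6
  (leaf #1 #2 #3 #6 red) (node #5 #6 (leaf #2 #3 #5 #6 red) (leaf #0 #2 #5 #6 blue))))
  (leaf #8 #3 #1 #4 blue)) (leaf #7 #3 #1 #4 blue)) (leaf #6 #3 #1 #4 blue)) (leaf #5 #3 #1 #4 blue))))))
  (node #2 #4 (node #3 #4 (node #3 #5 (leaf #5 #3 #2 #4 red) (node #3 #6 (leaf #6 #3 #2 #4 red)
  (node #3 #7 (leaf #7 #3 #2 #4 red) (node #3 #8 (leaf #8 #3 #2 #4 red) (node #1 #3 (node #0 #3
  (node #1 #5 (leaf #5 #1 #0 #3 red) (node #1 #4 (leaf #4 #1 #0 #3 red) (node #1 #6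
  (leaf #6 #1 #0 #3 red) (node #5 #6 (node #1 #7 (leaf #7 #1 #0 #3 red) (node #1 #8
  (leaf #8 #1 #0 #3 red) (node #0 #2 (leaf #4 #2 #0 #3 red) (node #4 #5 (node #4 #6
  (leaf #2 #4 #5 #6 red) (node #4 #7 (node #4 #8 (node #2 #7 (leaf #5 #4 #2 #7 red) (node #2 #5
  (leaf #7 #4 #2 #5 red) (leaf #7 #2 #1 #5 blue))) (leaf #8 #4 #1 #6 blue)) (leaf #7 #4 #1 #6 blue)))
  (node #4 #6 (node #4 #7 (node #4 #8 (node #2 #7 (leaf #6 #4 #2 #7 red) (node #2 #6
  (leaf #7 #4 #2 #6 red) (leaf #7 #2 #1 #6 blue))) (leaf #8 #4 #1 #5 blue)) (leaf #7 #4 #1 #5 blue))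
  (leaf #6 #4 #1 #5 blue)))))) (node #1 #7 (leaf #7 #1 #0 #3 red) (node #4 #5 (node #2 #5
  (node #4 #6 (leaf #6 #4 #2 #5 red) (node #4 #7 (leaf #7 #4 #2 #5 red) (leaf #7 #4 #1 #6 blue)))
  (node #2 #6 (node #2 #7 (node #2 #8 (node #4 #6 (leaf #5 #4 #2 #6 red) (node #4 #7
  (leaf #5 #4 #2 #7 red) (leaf #7 #4 #1 #6 blue))) (leaf #8 #2 #1 #5 blue)) (leaf #7 #2 #1 #5 blue))
  (leaf #6 #2 #1 #5 blue))) (node #1 #8 (leaf #8 #1 #0 #3 red) (node #4 #6 (node #4 #7 (node #4 #8
  (node #6 #7 (leaf #2 #4 #6 #7 red) (node #6 #8 (leaf #2 #4 #6 #8 red) (leaf #8 #6 #1 #7 blue)))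
  (leaf #8 #4 #1 #5 blue)) (leaf #7 #4 #1 #5 blue)) (leaf #6 #4 #1 #5 blue))))))))) (node #0 #5
  (node #5 #6 (node #5 #7 (node #0 #6 (leaf #7 #5 #0 #6 red) (leaf #5 #3 #0 #6 blue))
  (leaf #0 #3 #5 #7 blue)) (leaf #0 #3 #5 #6 blue)) (leaf #6 #3 #0 #5 blue))) (node #1 #5
  (node #1 #6 (node #5 #6 (leaf #0 #1 #5 #6 red) (leaf #1 #3 #5 #6 blue)) (leaf #5 #3 #1 #6 blue))
  (leaf #6 #3 #1 #5 blue))))))) (node #0 #2 (node #0 #3 (leaf #4 #2 #0 #3 red) (node #0 #4
  (leaf #3 #2 #0 #4 red) (node #3 #5 (node #3 #6 (node #3 #7 (node #3 #8 (node #5 #6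
  (leaf #2 #3 #5 #6 red) (node #5 #7 (leaf #2 #3 #5 #7 red) (node #2 #5 (leaf #0 #2 #3 #5 red)
  (node #2 #6 (leaf #0 #2 #3 #6 red) (leaf #1 #2 #5 #6 blue))))) (leaf #8 #3 #0 #4 blue))
  (leaf #7 #3 #0 #4 blue)) (leaf #6 #3 #0 #4 blue)) (leaf #5 #3 #0 #4 blue)))) (node #4 #5
  (node #1 #3 (node #1 #5 (node #0 #3 (leaf #5 #1 #0 #3 red) (node #3 #5 (leaf #0 #1 #3 #5 red)
  (node #0 #5 (leaf #3 #1 #0 #5 red) (leaf #4 #3 #0 #5 blue)))) (node #0 #3 (node #1 #6
  (leaf #6 #1 #0 #3 red) (node #1 #7 (leaf #7 #1 #0 #3 red) (node #1 #8 (leaf #8 #1 #0 #3 red)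
  (node #2 #5 (node #4 #6 (leaf #6 #4 #2 #5 red) (node #4 #7 (leaf #7 #4 #2 #5 red) (node #4 #8
  (leaf #8 #4 #2 #5 red) (node #1 #4 (leaf #4 #1 #0 #3 red) (leaf #7 #4 #1 #6 blue))))) (node #2 #6
  (node #4 #6 (leaf #5 #4 #2 #6 red) (node #1 #4 (leaf #4 #1 #0 #3 red) (node #4 #7 (node #2 #7
  (leaf #5 #4 #2 #7 red) (leaf #7 #2 #1 #5 blue)) (leaf #7 #4 #1 #6 blue)))) (leaf #6 #2 #1 #5 blue))))))
  (node #3 #6 (node #3 #7 (node #2 #6 (leaf #7 #3 #2 #6 red) (node #2 #7 (leaf #6 #3 #2 #7 red)
  (node #6 #7 (leaf #1 #3 #6 #7 red) (leaf #0 #2 #6 #7 blue)))) (node #4 #7 (node #0 #4 (node #0 #7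
  (leaf #5 #4 #0 #7 red) (leaf #4 #3 #0 #7 blue)) (leaf #7 #3 #0 #4 blue)) (leaf #0 #3 #4 #7 blue)))
  (node #4 #6 (node #0 #4 (node #0 #6 (leaf #5 #4 #0 #6 red) (leaf #4 #3 #0 #6 blue))
  (leaf #6 #3 #0 #4 blue)) (leaf #0 #3 #4 #6 blue))))) (node #1 #4 (node #4 #6 (node #2 #5
  (leaf #6 #4 #2 #5 red) (node #2 #6 (leaf #5 #4 #2 #6 red) (node #5 #6 (leaf #1 #4 #5 #6 red)
  (leaf #0 #2 #5 #6 blue)))) (node #4 #7 (node #2 #5 (leaf #7 #4 #2 #5 red) (node #2 #7
  (leaf #5 #4 #2 #7 red) (node #5 #7 (leaf #1 #4 #5 #7 red) (leaf #0 #2 #5 #7 blue)))) (node #3 #6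
  (node #3 #7 (node #6 #7 (leaf #2 #3 #6 #7 red) (leaf #3 #4 #6 #7 blue)) (leaf #1 #3 #4 #7 blue))
  (leaf #1 #3 #4 #6 blue)))) (node #3 #5 (node #3 #6 (node #3 #7 (node #3 #8 (node #2 #5
  (leaf #6 #3 #2 #5 red) (node #2 #6 (leaf #5 #3 #2 #6 red) (node #5 #6 (leaf #2 #3 #5 #6 red)
  (leaf #0 #2 #5 #6 blue)))) (leaf #8 #3 #1 #4 blue)) (leaf #7 #3 #1 #4 blue))
  (leaf #6 #3 #1 #4 blue)) (leaf #5 #3 #1 #4 blue)))) (node #1 #3 (node #3 #5 (node #3 #6
  (node #2 #5 (leaf #6 #3 #2 #5 red) (node #2 #6 (leaf #5 #3 #2 #6 red) (node #5 #6
  (leaf #1 #3 #5 #6 red) (leaf #0 #2 #5 #6 blue)))) (node #3 #7 (node #2 #5 (leaf #7 #3 #2 #5 red)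
  (node #2 #7 (leaf #5 #3 #2 #7 red) (node #5 #7 (leaf #1 #3 #5 #7 red) (leaf #0 #2 #5 #7 blue))))
  (node #0 #3 (node #4 #6 (node #4 #7 (node #2 #6 (leaf #7 #4 #2 #6 red) (node #2 #7
  (leaf #6 #4 #2 #7 red) (node #6 #7 (leaf #2 #4 #6 #7 red) (leaf #0 #2 #6 #7 blue))))
  (leaf #5 #4 #3 #7 blue)) (leaf #5 #4 #3 #6 blue)) (node #3 #8 (node #2 #5 (leaf #8 #3 #2 #5 red)
  (node #2 #8 (leaf #5 #3 #2 #8 red) (node #5 #8 (leaf #1 #3 #5 #8 red) (leaf #0 #2 #5 #8 blue))))
  (node #4 #6 (node #4 #7 (node #6 #7 (leaf #2 #4 #6 #7 red) (leaf #0 #3 #6 #7 blue))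
  (leaf #0 #3 #4 #7 blue)) (leaf #0 #3 #4 #6 blue)))))) (node #0 #3 (node #4 #6 (node #4 #7
  (node #4 #8 (node #2 #6 (leaf #7 #4 #2 #6 red) (node #2 #7 (leaf #6 #4 #2 #7 red) (node #6 #7
  (leaf #2 #4 #6 #7 red) (leaf #0 #2 #6 #7 blue)))) (leaf #8 #4 #3 #5 blue)) (leaf #7 #4 #3 #5 blue))
  (leaf #6 #4 #3 #5 blue)) (leaf #0 #3 #4 #5 blue))) (node #3 #5 (node #3 #6 (node #2 #5
  (leaf #6 #3 #2 #5 red) (node #2 #6 (leaf #5 #3 #2 #6 red) (node #5 #6 (leaf #2 #3 #5 #6 red)
  (leaf #0 #2 #5 #6 blue)))) (node #3 #7 (node #2 #5 (leaf #7 #3 #2 #5 red) (node #2 #7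
  (leaf #5 #3 #2 #7 red) (node #5 #7 (leaf #2 #3 #5 #7 red) (leaf #0 #2 #5 #7 blue)))) (node #3 #8
  (node #2 #5 (leaf #8 #3 #2 #5 red) (node #2 #8 (leaf #5 #3 #2 #8 red) (node #5 #8
  (leaf #2 #3 #5 #8 red) (leaf #0 #2 #5 #8 blue)))) (node #1 #6 (node #1 #4 (node #4 #6
  (leaf #0 #1 #4 #6 red) (leaf #1 #3 #4 #6 blue)) (leaf #6 #3 #1 #4 blue)) (leaf #4 #3 #1 #6 blue)))))
  (leaf #1 #3 #4 #5 blue)))))) (node #1 #4 (node #1 #3 (node #0 #4 (leaf #3 #1 #0 #4 red)
  (node #3 #4 (leaf #0 #1 #3 #4 red) (node #0 #3 (leaf #4 #1 #0 #3 red) (node #3 #5 (node #3 #6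
  (node #3 #7 (node #3 #8 (node #2 #5 (leaf #6 #3 #2 #5 red) (node #1 #5 (leaf #0 #1 #3 #5 red)
  (leaf #4 #2 #1 #5 blue))) (leaf #8 #3 #0 #4 blue)) (leaf #7 #3 #0 #4 blue))
  (leaf #6 #3 #0 #4 blue)) (leaf #5 #3 #0 #4 blue))))) (node #4 #5 (node #4 #6 (node #1 #5
  (leaf #0 #1 #4 #5 red) (node #5 #6 (leaf #1 #4 #5 #6 red) (node #1 #6 (leaf #0 #1 #4 #6 red)
  (node #3 #5 (node #2 #5 (node #5 #7 (node #5 #8 (node #2 #7 (leaf #8 #5 #2 #7 red) (node #4 #7
  (leaf #1 #4 #5 #7 red) (leaf #1 #2 #4 #7 blue))) (leaf #8 #5 #1 #6 blue)) (leaf #7 #5 #1 #6 blue))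
  (leaf #4 #2 #1 #5 blue)) (node #3 #4 (node #3 #6 (leaf #2 #3 #4 #6 red) (leaf #6 #3 #1 #5 blue))
  (leaf #4 #3 #1 #5 blue)))))) (node #1 #5 (leaf #0 #1 #4 #5 red) (node #2 #5 (node #3 #5
  (node #3 #4 (leaf #4 #3 #2 #5 red) (node #3 #6 (leaf #6 #3 #2 #5 red) (leaf #1 #3 #4 #6 blue)))
  (node #2 #6 (node #3 #6 (node #3 #7 (leaf #7 #3 #2 #6 red) (leaf #7 #3 #1 #5 blue))
  (leaf #6 #3 #1 #5 blue)) (leaf #1 #2 #4 #6 blue))) (leaf #4 #2 #1 #5 blue)))) (node #4 #6
  (node #2 #5 (node #1 #6 (leaf #0 #1 #4 #6 red) (node #2 #6 (node #3 #6 (node #3 #4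
  (leaf #4 #3 #2 #6 red) (node #3 #5 (leaf #6 #3 #2 #5 red) (leaf #1 #3 #4 #5 blue))) (node #3 #5
  (node #3 #7 (leaf #7 #3 #2 #5 red) (leaf #7 #3 #1 #6 blue)) (leaf #5 #3 #1 #6 blue)))
  (leaf #4 #2 #1 #6 blue))) (leaf #1 #2 #4 #5 blue)) (node #2 #5 (node #5 #6 (node #3 #5 (node #3 #4
  (leaf #4 #3 #2 #5 red) (node #3 #6 (leaf #6 #3 #2 #5 red) (leaf #1 #3 #4 #6 blue))) (node #2 #6
  (node #5 #7 (leaf #7 #5 #2 #6 red) (node #5 #8 (leaf #8 #5 #2 #6 red) (node #3 #7 (node #3 #6
  (leaf #7 #3 #2 #6 red) (node #1 #6 (node #1 #5 (leaf #0 #1 #5 #6 red) (leaf #6 #3 #1 #5 blue))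
  (leaf #5 #3 #1 #6 blue))) (leaf #1 #3 #5 #7 blue)))) (leaf #1 #2 #4 #6 blue)))
  (leaf #2 #4 #5 #6 blue)) (leaf #1 #2 #4 #5 blue))))) (node #2 #5 (node #2 #6 (node #2 #7
  (node #2 #8 (node #3 #5 (node #3 #4 (leaf #4 #3 #2 #5 red) (node #3 #6 (leaf #6 #3 #2 #5 red)
  (node #3 #7 (leaf #7 #3 #2 #5 red) (node #3 #8 (leaf #8 #3 #2 #5 red) (node #0 #3 (node #1 #3
  (node #1 #5 (leaf #5 #1 #0 #3 red) (node #1 #6 (leaf #6 #1 #0 #3 red) (node #4 #5 (node #1 #7
  (leaf #7 #1 #0 #3 red) (node #4 #6 (node #5 #6 (node #5 #7 (leaf #7 #5 #2 #6 red) (node #5 #8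
  (leaf #8 #5 #2 #6 red) (leaf #8 #5 #1 #7 blue))) (node #5 #7 (node #5 #8 (leaf #8 #5 #2 #7 red)
  (leaf #8 #5 #1 #6 blue)) (leaf #7 #5 #1 #6 blue))) (node #1 #8 (leaf #8 #1 #0 #3 red) (node #4 #7
  (node #5 #7 (node #4 #8 (node #5 #6 (leaf #7 #5 #2 #6 red) (node #5 #8 (leaf #8 #5 #2 #7 red)
  (leaf #8 #5 #1 #6 blue))) (leaf #8 #4 #1 #6 blue)) (node #5 #8 (node #5 #6 (leaf #8 #5 #2 #6 red)
  (leaf #7 #5 #1 #6 blue)) (leaf #8 #5 #1 #7 blue))) (leaf #7 #4 #1 #6 blue))))) (node #1 #7
  (leaf #7 #1 #0 #3 red) (node #1 #8 (leaf #8 #1 #0 #3 red) (node #5 #6 (node #5 #7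
  (leaf #7 #5 #2 #6 red) (node #5 #8 (leaf #8 #5 #2 #6 red) (leaf #8 #5 #1 #7 blue))) (node #5 #7
  (node #5 #8 (leaf #8 #5 #2 #7 red) (leaf #8 #5 #1 #6 blue)) (leaf #7 #5 #1 #6 blue))))))))
  (leaf #6 #3 #1 #4 blue)) (node #0 #6 (node #6 #7 (node #6 #8 (leaf #8 #6 #2 #7 red)
  (leaf #0 #3 #6 #8 blue)) (leaf #0 #3 #6 #7 blue)) (leaf #4 #3 #0 #6 blue))))))) (node #0 #2
  (node #0 #3 (leaf #5 #2 #0 #3 red) (node #3 #6 (leaf #0 #2 #3 #6 red) (node #5 #6
  (leaf #0 #2 #5 #6 red) (leaf #0 #3 #5 #6 blue)))) (node #3 #4 (node #3 #6 (leaf #4 #3 #2 #6 red)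
  (node #3 #7 (leaf #4 #3 #2 #7 red) (node #3 #8 (leaf #4 #3 #2 #8 red) (node #1 #3 (node #0 #3
  (node #1 #5 (leaf #5 #1 #0 #3 red) (node #1 #6 (leaf #6 #1 #0 #3 red) (node #5 #6 (node #5 #7
  (leaf #7 #5 #2 #6 red) (node #5 #8 (leaf #8 #5 #2 #6 red) (leaf #8 #5 #3 #7 blue))) (node #5 #7
  (node #5 #8 (leaf #8 #5 #2 #7 red) (leaf #8 #5 #1 #6 blue)) (leaf #7 #5 #1 #6 blue)))))
  (node #5 #6 (node #5 #7 (leaf #7 #5 #2 #6 red) (leaf #0 #3 #5 #7 blue)) (leaf #0 #3 #5 #6 blue)))
  (node #5 #6 (node #5 #7 (leaf #7 #5 #2 #6 red) (leaf #1 #3 #5 #7 blue)) (leaf #1 #3 #5 #6 blue))))))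
  (node #1 #3 (node #4 #5 (node #0 #3 (node #1 #6 (leaf #6 #1 #0 #3 red) (node #1 #5
  (leaf #5 #1 #0 #3 red) (node #1 #7 (leaf #7 #1 #0 #3 red) (node #1 #8 (leaf #8 #1 #0 #3 red)
  (node #5 #6 (node #5 #7 (leaf #7 #5 #2 #6 red) (node #5 #8 (leaf #8 #5 #2 #6 red)
  (leaf #8 #5 #1 #7 blue))) (node #5 #7 (node #5 #8 (leaf #8 #5 #2 #7 red) (leaf #8 #5 #1 #6 blue))
  (leaf #7 #5 #1 #6 blue))))))) (node #0 #5 (node #0 #4 (node #4 #6 (leaf #6 #4 #0 #5 red)
  (node #4 #7 (leaf #7 #4 #0 #5 red) (node #4 #8 (leaf #8 #4 #0 #5 red) (node #3 #6 (node #3 #7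
  (leaf #7 #3 #2 #6 red) (leaf #0 #3 #4 #7 blue)) (leaf #0 #3 #4 #6 blue)))))
  (leaf #5 #3 #0 #4 blue)) (leaf #4 #3 #0 #5 blue))) (node #0 #3 (node #1 #5 (leaf #5 #1 #0 #3 red)
  (node #1 #6 (leaf #6 #1 #0 #3 red) (node #5 #6 (node #5 #7 (leaf #7 #5 #2 #6 red) (node #5 #8
  (leaf #8 #5 #2 #6 red) (node #1 #7 (leaf #7 #1 #0 #3 red) (leaf #8 #5 #1 #7 blue)))) (node #1 #7
  (leaf #7 #1 #0 #3 red) (node #1 #8 (leaf #8 #1 #0 #3 red) (node #5 #7 (node #5 #8
  (leaf #8 #5 #2 #7 red) (leaf #8 #5 #1 #6 blue)) (leaf #7 #5 #1 #6 blue)))))))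
  (leaf #0 #3 #4 #5 blue))) (leaf #5 #3 #1 #4 blue))))) (leaf #8 #2 #1 #4 blue))
  (leaf #7 #2 #1 #4 blue)) (leaf #6 #2 #1 #4 blue)) (leaf #5 #2 #1 #4 blue))))) (node #1 #2
  (node #1 #4 (node #0 #2 (leaf #4 #1 #0 #2 red) (node #2 #4 (leaf #0 #1 #2 #4 red) (node #0 #4
  (leaf #2 #1 #0 #4 red) (leaf #3 #2 #0 #4 blue)))) (node #0 #2 (node #1 #3 (leaf #3 #1 #0 #2 red)
  (node #1 #5 (leaf #5 #1 #0 #2 red) (node #1 #6 (leaf #6 #1 #0 #2 red) (node #3 #4 (node #3 #5
  (node #1 #7 (leaf #7 #1 #0 #2 red) (node #1 #8 (leaf #8 #1 #0 #2 red) (node #4 #5 (node #4 #6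
  (leaf #6 #4 #3 #5 red) (node #4 #7 (leaf #7 #4 #3 #5 red) (leaf #7 #4 #1 #6 blue))) (node #4 #6
  (node #4 #7 (node #4 #8 (node #3 #6 (leaf #7 #4 #3 #6 red) (node #3 #7 (leaf #6 #4 #3 #7 red)
  (leaf #7 #3 #1 #6 blue))) (leaf #8 #4 #1 #5 blue)) (leaf #7 #4 #1 #5 blue))
  (leaf #6 #4 #1 #5 blue))))) (node #1 #7 (leaf #7 #1 #0 #2 red) (node #1 #8 (leaf #8 #1 #0 #2 red)
  (node #5 #6 (node #3 #6 (node #3 #7 (node #4 #6 (node #4 #5 (leaf #5 #4 #3 #6 red) (node #4 #7
  (leaf #7 #4 #3 #6 red) (leaf #7 #4 #1 #5 blue))) (node #4 #7 (node #4 #5 (leaf #5 #4 #3 #7 red)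
  (leaf #6 #4 #1 #5 blue)) (leaf #7 #4 #1 #6 blue))) (leaf #7 #3 #1 #5 blue))
  (leaf #6 #3 #1 #5 blue)) (node #4 #6 (node #3 #6 (node #4 #5 (leaf #5 #4 #3 #6 red) (node #4 #7
  (leaf #7 #4 #3 #6 red) (leaf #7 #4 #1 #5 blue))) (leaf #6 #3 #1 #5 blue)) (node #4 #7 (node #4 #8
  (node #3 #7 (leaf #8 #4 #3 #7 red) (leaf #7 #3 #1 #5 blue)) (leaf #8 #4 #1 #6 blue))
  (leaf #7 #4 #1 #6 blue))))))) (node #1 #7 (leaf #7 #1 #0 #2 red) (node #1 #8
  (leaf #8 #1 #0 #2 red) (node #4 #5 (node #4 #6 (node #2 #4 (node #5 #6 (leaf #2 #4 #5 #6 red)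
  (node #4 #7 (node #5 #7 (leaf #2 #4 #5 #7 red) (leaf #7 #5 #1 #6 blue)) (node #4 #8 (node #5 #8
  (leaf #2 #4 #5 #8 red) (leaf #8 #5 #1 #6 blue)) (leaf #8 #4 #1 #7 blue)))) (node #3 #5 (node #3 #6
  (node #5 #6 (node #3 #7 (node #3 #8 (node #5 #7 (leaf #7 #5 #3 #6 red) (node #5 #8
  (leaf #8 #5 #3 #6 red) (leaf #8 #5 #1 #7 blue))) (leaf #8 #3 #1 #4 blue)) (leaf #7 #3 #1 #4 blue))
  (node #5 #7 (node #5 #8 (node #3 #7 (leaf #8 #5 #3 #7 red) (leaf #7 #3 #1 #4 blue))
  (leaf #8 #5 #1 #6 blue)) (leaf #7 #5 #1 #6 blue))) (leaf #6 #3 #1 #4 blue))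
  (leaf #5 #3 #1 #4 blue))) (node #4 #7 (node #2 #4 (node #4 #8 (node #5 #7 (leaf #2 #4 #5 #7 red)
  (node #5 #8 (leaf #2 #4 #5 #8 red) (leaf #8 #5 #1 #7 blue))) (leaf #8 #4 #1 #6 blue)) (node #4 #8
  (node #3 #5 (node #3 #6 (node #3 #7 (node #5 #7 (node #3 #8 (node #5 #6 (leaf #7 #5 #3 #6 red)
  (node #5 #8 (leaf #8 #5 #3 #7 red) (leaf #8 #5 #1 #6 blue))) (leaf #8 #3 #1 #4 blue)) (node #5 #8
  (node #5 #6 (leaf #8 #5 #3 #6 red) (leaf #7 #5 #1 #6 blue)) (leaf #8 #5 #1 #7 blue)))
  (leaf #7 #3 #1 #4 blue)) (leaf #6 #3 #1 #4 blue)) (leaf #5 #3 #1 #4 blue)) (leaf #8 #4 #1 #6 blue)))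
  (leaf #7 #4 #1 #6 blue))) (node #5 #6 (node #3 #5 (node #3 #6 (node #5 #7 (leaf #7 #5 #3 #6 red)
  (node #5 #8 (leaf #8 #5 #3 #6 red) (leaf #8 #5 #1 #7 blue))) (leaf #6 #3 #1 #4 blue))
  (leaf #5 #3 #1 #4 blue)) (node #4 #6 (node #4 #7 (node #2 #4 (node #4 #8 (node #6 #7
  (leaf #2 #4 #6 #7 red) (node #6 #8 (leaf #2 #4 #6 #8 red) (leaf #8 #6 #1 #7 blue)))
  (leaf #8 #4 #1 #5 blue)) (node #4 #8 (node #5 #7 (node #5 #8 (node #3 #5 (node #3 #7
  (leaf #8 #5 #3 #7 red) (leaf #7 #3 #1 #4 blue)) (leaf #5 #3 #1 #4 blue)) (leaf #8 #5 #1 #6 blue))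
  (leaf #7 #5 #1 #6 blue)) (leaf #8 #4 #1 #5 blue))) (leaf #7 #4 #1 #5 blue))
  (leaf #6 #4 #1 #5 blue)))))))))) (node #2 #5 (node #1 #5 (leaf #0 #1 #2 #5 red) (node #2 #6
  (node #5 #6 (leaf #1 #2 #5 #6 red) (node #4 #5 (node #2 #4 (leaf #1 #2 #4 #5 red) (node #3 #4
  (node #0 #3 (node #0 #4 (node #3 #5 (leaf #5 #3 #0 #4 red) (node #3 #6 (leaf #6 #3 #0 #4 red)
  (leaf #2 #3 #5 #6 blue))) (leaf #3 #2 #0 #4 blue)) (leaf #4 #2 #0 #3 blue))
  (leaf #0 #2 #3 #4 blue))) (node #1 #6 (leaf #0 #1 #2 #6 red) (node #4 #6 (node #2 #4
  (leaf #1 #2 #4 #6 red) (node #0 #3 (node #3 #4 (node #4 #7 (node #4 #8 (node #0 #4 (node #3 #5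
  (leaf #5 #3 #0 #4 red) (node #3 #6 (leaf #6 #3 #0 #4 red) (leaf #2 #3 #5 #6 blue)))
  (leaf #3 #2 #0 #4 blue)) (leaf #8 #4 #1 #5 blue)) (leaf #7 #4 #1 #5 blue)) (leaf #0 #2 #3 #4 blue))
  (leaf #4 #2 #0 #3 blue))) (leaf #6 #4 #1 #5 blue))))) (node #0 #3 (node #3 #6 (node #0 #6
  (node #3 #4 (leaf #4 #3 #0 #6 red) (node #3 #7 (leaf #7 #3 #0 #6 red) (node #1 #3
  (leaf #2 #1 #0 #3 red) (leaf #7 #3 #1 #4 blue)))) (leaf #3 #2 #0 #6 blue)) (leaf #0 #2 #3 #6 blue))
  (leaf #6 #2 #0 #3 blue)))) (node #0 #3 (node #3 #5 (node #0 #5 (node #3 #4 (leaf #4 #3 #0 #5 red)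
  (node #3 #6 (leaf #6 #3 #0 #5 red) (node #1 #3 (leaf #2 #1 #0 #3 red) (leaf #6 #3 #1 #4 blue))))
  (leaf #3 #2 #0 #5 blue)) (leaf #0 #2 #3 #5 blue)) (leaf #5 #2 #0 #3 blue))))) (node #2 #4
  (node #1 #3 (node #3 #5 (node #3 #4 (node #3 #6 (node #5 #6 (leaf #1 #3 #5 #6 red) (node #1 #5
  (leaf #0 #1 #3 #5 red) (node #4 #5 (leaf #1 #3 #4 #5 red) (node #4 #6 (leaf #1 #3 #4 #6 red)
  (node #1 #4 (leaf #0 #1 #3 #4 red) (leaf #6 #4 #1 #5 blue)))))) (node #3 #7 (node #3 #8
  (node #2 #6 (node #5 #7 (leaf #1 #3 #5 #7 red) (node #5 #8 (leaf #1 #3 #5 #8 red) (node #4 #5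
  (leaf #1 #3 #4 #5 red) (node #4 #7 (leaf #1 #3 #4 #7 red) (leaf #8 #5 #4 #7 blue)))))
  (leaf #1 #2 #3 #6 blue)) (node #0 #3 (node #6 #8 (node #2 #6 (node #2 #8 (node #5 #7
  (leaf #0 #3 #5 #7 red) (node #4 #5 (leaf #0 #3 #4 #5 red) (node #4 #7 (leaf #0 #3 #4 #7 red)
  (node #1 #4 (leaf #4 #1 #0 #3 red) (leaf #1 #4 #5 #7 blue))))) (leaf #1 #2 #3 #8 blue))
  (leaf #1 #2 #3 #6 blue)) (leaf #2 #3 #6 #8 blue)) (node #0 #6 (node #2 #6 (node #0 #2
  (leaf #4 #2 #0 #6 red) (node #6 #8 (node #0 #8 (node #5 #7 (leaf #1 #3 #5 #7 red) (node #4 #5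
  (leaf #1 #3 #4 #5 red) (node #4 #7 (leaf #1 #3 #4 #7 red) (node #1 #4 (leaf #0 #1 #3 #4 red)
  (leaf #1 #4 #5 #7 blue))))) (leaf #6 #3 #0 #8 blue)) (leaf #0 #3 #6 #8 blue)))
  (leaf #1 #2 #3 #6 blue)) (leaf #8 #3 #0 #6 blue)))) (node #3 #8 (node #0 #3 (node #6 #7
  (node #2 #6 (node #2 #7 (node #5 #8 (leaf #0 #3 #5 #8 red) (node #4 #5 (leaf #0 #3 #4 #5 red)
  (node #4 #8 (leaf #0 #3 #4 #8 red) (node #1 #4 (leaf #4 #1 #0 #3 red) (leaf #1 #4 #5 #8 blue)))))
  (leaf #1 #2 #3 #7 blue)) (leaf #1 #2 #3 #6 blue)) (leaf #2 #3 #6 #7 blue)) (node #0 #6 (node #2 #6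
  (node #0 #2 (leaf #4 #2 #0 #6 red) (node #6 #7 (node #0 #7 (node #5 #8 (leaf #1 #3 #5 #8 red)
  (node #4 #5 (leaf #1 #3 #4 #5 red) (node #4 #8 (leaf #1 #3 #4 #8 red) (node #1 #4
  (leaf #0 #1 #3 #4 red) (leaf #1 #4 #5 #8 blue))))) (leaf #6 #3 #0 #7 blue))
  (leaf #0 #3 #6 #7 blue))) (leaf #1 #2 #3 #6 blue)) (leaf #7 #3 #0 #6 blue))) (node #0 #3
  (node #6 #7 (node #6 #8 (node #7 #8 (node #2 #6 (leaf #2 #6 #7 #8 red) (leaf #1 #2 #3 #6 blue))
  (leaf #2 #3 #7 #8 blue)) (leaf #2 #3 #6 #8 blue)) (leaf #2 #3 #6 #7 blue)) (node #0 #2 (node #2 #6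
  (node #0 #6 (leaf #4 #2 #0 #6 red) (leaf #7 #3 #0 #6 blue)) (leaf #1 #2 #3 #6 blue)) (node #6 #7
  (node #6 #8 (node #7 #8 (node #0 #6 (leaf #0 #6 #7 #8 red) (leaf #7 #3 #0 #6 blue))
  (leaf #0 #3 #7 #8 blue)) (leaf #0 #3 #6 #8 blue)) (leaf #0 #3 #6 #7 blue))))))) (node #1 #5
  (leaf #0 #1 #3 #5 red) (node #2 #5 (node #3 #6 (node #5 #6 (leaf #1 #3 #5 #6 red) (node #1 #6
  (leaf #0 #1 #3 #6 red) (node #5 #7 (node #5 #8 (node #2 #7 (leaf #8 #5 #2 #7 red) (node #3 #7
  (leaf #1 #3 #5 #7 red) (leaf #1 #2 #3 #7 blue))) (leaf #8 #5 #1 #6 blue)) (leaf #7 #5 #1 #6 blue))))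
  (node #4 #6 (node #2 #6 (node #4 #7 (leaf #7 #4 #2 #6 red) (node #4 #8 (leaf #8 #4 #2 #6 red)
  (node #4 #5 (leaf #6 #4 #2 #5 red) (node #5 #7 (node #3 #7 (leaf #1 #3 #5 #7 red)
  (leaf #2 #3 #4 #7 blue)) (leaf #3 #4 #5 #7 blue))))) (leaf #1 #2 #3 #6 blue))
  (leaf #2 #3 #4 #6 blue))) (leaf #3 #2 #1 #5 blue)))) (node #2 #5 (node #0 #3 (node #1 #6
  (leaf #6 #1 #0 #3 red) (node #2 #6 (node #4 #5 (node #4 #6 (leaf #6 #4 #2 #5 red) (node #4 #7
  (leaf #7 #4 #2 #5 red) (node #1 #4 (leaf #4 #1 #0 #3 red) (leaf #7 #4 #1 #6 blue)))) (node #3 #4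
  (node #3 #7 (node #4 #6 (node #3 #8 (node #4 #7 (leaf #0 #3 #4 #7 red) (node #1 #4
  (leaf #4 #1 #0 #3 red) (node #1 #7 (leaf #7 #1 #0 #3 red) (leaf #5 #4 #1 #7 blue)))) (node #2 #8
  (node #5 #8 (node #5 #6 (leaf #8 #5 #2 #6 red) (node #3 #6 (leaf #0 #3 #4 #6 red)
  (leaf #2 #3 #5 #6 blue))) (leaf #2 #3 #5 #8 blue)) (leaf #1 #2 #3 #8 blue))) (node #1 #4
  (leaf #4 #1 #0 #3 red) (leaf #5 #4 #1 #6 blue))) (node #1 #4 (leaf #4 #1 #0 #3 red) (node #4 #6
  (node #4 #8 (leaf #8 #4 #2 #6 red) (node #1 #8 (leaf #8 #1 #0 #3 red) (leaf #5 #4 #1 #8 blue)))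
  (leaf #5 #4 #1 #6 blue)))) (leaf #2 #3 #4 #5 blue))) (leaf #3 #2 #1 #6 blue))) (node #3 #4
  (node #3 #6 (node #4 #5 (node #0 #2 (leaf #0 #2 #4 #5 red) (node #2 #6 (node #2 #7 (node #5 #6
  (node #5 #7 (leaf #7 #5 #2 #6 red) (node #3 #7 (node #3 #8 (node #2 #8 (node #5 #8
  (leaf #8 #5 #2 #6 red) (node #7 #8 (leaf #1 #3 #7 #8 red) (leaf #3 #5 #7 #8 blue)))
  (leaf #8 #2 #0 #3 blue)) (node #5 #8 (leaf #8 #5 #2 #6 red) (leaf #0 #3 #5 #8 blue)))
  (leaf #0 #3 #5 #7 blue))) (node #2 #8 (node #4 #6 (leaf #1 #3 #4 #6 red) (node #4 #7
  (leaf #7 #4 #2 #5 red) (node #1 #4 (leaf #0 #1 #3 #4 red) (node #1 #6 (leaf #0 #1 #3 #6 red)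
  (leaf #7 #4 #1 #6 blue))))) (leaf #8 #2 #0 #3 blue))) (leaf #7 #2 #0 #3 blue))
  (leaf #6 #2 #0 #3 blue))) (node #4 #6 (leaf #1 #3 #4 #6 red) (node #1 #4 (leaf #0 #1 #3 #4 red)
  (node #1 #6 (leaf #0 #1 #3 #6 red) (leaf #5 #4 #1 #6 blue))))) (node #3 #7 (node #3 #8 (node #5 #6
  (node #0 #5 (node #2 #6 (node #0 #6 (node #0 #2 (leaf #4 #2 #0 #5 red) (node #2 #7 (node #2 #8
  (node #4 #7 (leaf #1 #3 #4 #7 red) (node #1 #4 (leaf #0 #1 #3 #4 red) (node #4 #8
  (leaf #1 #3 #4 #8 red) (node #1 #7 (leaf #0 #1 #3 #7 red) (leaf #8 #4 #1 #7 blue)))))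
  (leaf #8 #2 #0 #3 blue)) (leaf #7 #2 #0 #3 blue))) (leaf #5 #3 #0 #6 blue))
  (leaf #1 #2 #3 #6 blue)) (leaf #6 #3 #0 #5 blue)) (leaf #0 #3 #5 #6 blue)) (node #5 #6 (node #5 #8
  (node #6 #8 (leaf #2 #5 #6 #8 red) (leaf #0 #3 #6 #8 blue)) (leaf #0 #3 #5 #8 blue))
  (leaf #0 #3 #5 #6 blue))) (node #5 #6 (node #5 #7 (node #6 #7 (leaf #2 #5 #6 #7 red)
  (leaf #0 #3 #6 #7 blue)) (leaf #0 #3 #5 #7 blue)) (leaf #0 #3 #5 #6 blue)))) (node #4 #5
  (node #0 #4 (node #0 #5 (node #0 #2 (leaf #5 #2 #0 #4 red) (node #4 #6 (leaf #6 #4 #0 #5 red)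
  (node #4 #7 (leaf #7 #4 #0 #5 red) (node #4 #8 (leaf #8 #4 #0 #5 red) (node #1 #4
  (leaf #3 #1 #0 #4 red) (node #1 #6 (node #3 #6 (leaf #0 #1 #3 #6 red) (leaf #0 #3 #4 #6 blue))
  (leaf #7 #4 #1 #6 blue))))))) (leaf #4 #3 #0 #5 blue)) (leaf #5 #3 #0 #4 blue))
  (leaf #0 #3 #4 #5 blue)))) (leaf #1 #2 #3 #5 blue))) (node #2 #5 (node #2 #6 (node #2 #7
  (node #2 #8 (node #4 #5 (node #4 #6 (leaf #6 #4 #2 #5 red) (node #4 #7 (leaf #7 #4 #2 #5 red)
  (node #4 #8 (leaf #8 #4 #2 #5 red) (node #1 #4 (node #1 #5 (leaf #0 #1 #4 #5 red) (node #3 #6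
  (node #3 #4 (node #0 #2 (leaf #0 #2 #4 #5 red) (node #0 #4 (node #1 #7 (leaf #7 #1 #0 #4 red)
  (node #1 #8 (leaf #8 #1 #0 #4 red) (node #1 #6 (leaf #6 #1 #0 #4 red) (node #0 #3
  (leaf #6 #3 #0 #4 red) (node #5 #7 (node #5 #8 (leaf #8 #5 #2 #7 red) (node #5 #6
  (leaf #7 #5 #2 #6 red) (leaf #8 #5 #1 #6 blue))) (node #5 #6 (node #5 #8 (leaf #8 #5 #2 #6 red)
  (leaf #8 #5 #1 #7 blue)) (leaf #7 #5 #1 #6 blue))))))) (node #6 #7 (node #6 #8
  (leaf #8 #6 #2 #7 red) (leaf #0 #4 #6 #8 blue)) (leaf #0 #4 #6 #7 blue)))) (node #6 #7 (node #6 #8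
  (leaf #8 #6 #2 #7 red) (leaf #3 #4 #6 #8 blue)) (leaf #3 #4 #6 #7 blue))) (node #3 #5 (node #3 #4
  (node #0 #3 (leaf #0 #3 #4 #5 red) (node #0 #2 (leaf #0 #2 #4 #5 red) (node #6 #7 (node #6 #8
  (leaf #8 #6 #2 #7 red) (node #0 #4 (node #1 #6 (leaf #6 #1 #0 #4 red) (node #1 #7
  (leaf #7 #1 #0 #4 red) (node #1 #8 (leaf #8 #1 #0 #4 red) (node #3 #8 (node #5 #7 (node #5 #6
  (leaf #7 #5 #2 #6 red) (node #5 #8 (leaf #8 #5 #2 #7 red) (leaf #8 #5 #1 #6 blue))) (node #5 #8
  (node #5 #6 (leaf #8 #5 #2 #6 red) (leaf #7 #5 #1 #6 blue)) (leaf #8 #5 #1 #7 blue)))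
  (leaf #8 #3 #1 #6 blue))))) (leaf #0 #4 #6 #8 blue))) (node #0 #4 (node #1 #6
  (leaf #6 #1 #0 #4 red) (node #1 #7 (leaf #7 #1 #0 #4 red) (node #1 #8 (leaf #8 #1 #0 #4 red)
  (node #6 #8 (node #3 #7 (node #5 #8 (node #5 #6 (leaf #8 #5 #2 #6 red) (node #5 #7
  (leaf #8 #5 #2 #7 red) (leaf #7 #5 #1 #6 blue))) (node #5 #7 (node #5 #6 (leaf #7 #5 #2 #6 red)
  (leaf #8 #5 #1 #6 blue)) (leaf #8 #5 #1 #7 blue))) (leaf #7 #3 #1 #6 blue))
  (leaf #8 #6 #1 #7 blue))))) (leaf #0 #4 #6 #7 blue))))) (leaf #1 #3 #4 #6 blue))
  (leaf #6 #3 #1 #5 blue)))) (node #6 #7 (node #6 #8 (leaf #8 #6 #2 #7 red) (leaf #1 #4 #6 #8 blue))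
  (leaf #1 #4 #6 #7 blue)))))) (node #3 #4 (node #0 #2 (node #5 #6 (leaf #0 #2 #5 #6 red)
  (node #5 #7 (leaf #0 #2 #5 #7 red) (node #4 #6 (leaf #0 #2 #4 #6 red) (leaf #7 #5 #4 #6 blue))))
  (node #5 #6 (node #5 #7 (leaf #7 #5 #2 #6 red) (node #5 #8 (leaf #8 #5 #2 #6 red) (node #4 #7
  (node #4 #8 (leaf #8 #4 #2 #7 red) (leaf #7 #5 #4 #8 blue)) (leaf #8 #5 #4 #7 blue)))) (node #4 #6
  (node #4 #7 (leaf #7 #4 #2 #6 red) (node #4 #8 (leaf #8 #4 #2 #6 red) (node #5 #7 (node #5 #8
  (leaf #8 #5 #2 #7 red) (leaf #6 #5 #4 #8 blue)) (leaf #6 #5 #4 #7 blue)))) (node #5 #7 (node #5 #8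
  (leaf #8 #5 #2 #7 red) (leaf #8 #5 #4 #6 blue)) (leaf #7 #5 #4 #6 blue))))) (node #4 #6
  (node #4 #7 (leaf #7 #4 #2 #6 red) (node #4 #8 (leaf #8 #4 #2 #6 red) (node #5 #7 (node #5 #8
  (leaf #8 #5 #2 #7 red) (leaf #3 #4 #5 #8 blue)) (leaf #3 #4 #5 #7 blue)))) (node #5 #6 (node #4 #7
  (node #4 #8 (leaf #8 #4 #2 #7 red) (node #5 #8 (leaf #8 #5 #2 #6 red) (leaf #3 #4 #5 #8 blue)))
  (node #5 #7 (leaf #7 #5 #2 #6 red) (leaf #3 #4 #5 #7 blue))) (leaf #3 #4 #5 #6 blue)))))
  (leaf #8 #2 #1 #3 blue)) (leaf #7 #2 #1 #3 blue)) (leaf #6 #2 #1 #3 blue)) (leaf #5 #2 #1 #3 blue)))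
  (node #1 #3 (node #1 #4 (node #3 #4 (leaf #0 #1 #3 #4 red) (leaf #1 #2 #3 #4 blue))
  (leaf #3 #2 #1 #4 blue)) (leaf #4 #2 #1 #3 blue))))) (node #2 #3 (node #1 #2 (node #2 #4
  (node #1 #3 (leaf #4 #2 #1 #3 red) (node #1 #4 (leaf #3 #2 #1 #4 red) (node #3 #4
  (leaf #1 #2 #3 #4 red) (leaf #0 #1 #3 #4 blue)))) (node #1 #3 (node #2 #5 (leaf #5 #2 #1 #3 red)
  (node #2 #6 (leaf #6 #2 #1 #3 red) (node #2 #7 (leaf #7 #2 #1 #3 red) (node #2 #8
  (leaf #8 #2 #1 #3 red) (node #4 #5 (node #3 #4 (node #4 #6 (node #5 #6 (leaf #3 #4 #5 #6 red)
  (node #4 #7 (node #5 #7 (leaf #3 #4 #5 #7 red) (leaf #7 #5 #2 #6 blue)) (node #4 #8 (node #5 #8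
  (leaf #3 #4 #5 #8 red) (leaf #8 #5 #2 #6 blue)) (leaf #8 #4 #2 #7 blue)))) (node #4 #7 (node #4 #8
  (node #5 #7 (leaf #3 #4 #5 #7 red) (node #5 #8 (leaf #3 #4 #5 #8 red) (leaf #8 #5 #2 #7 blue)))
  (leaf #8 #4 #2 #6 blue)) (leaf #7 #4 #2 #6 blue))) (node #0 #2 (node #5 #6 (node #4 #6 (node #5 #7
  (leaf #7 #5 #4 #6 red) (node #5 #8 (leaf #8 #5 #4 #6 red) (leaf #8 #5 #2 #7 blue))) (node #4 #7
  (node #4 #8 (node #5 #7 (leaf #6 #5 #4 #7 red) (node #5 #8 (leaf #6 #5 #4 #8 red)
  (leaf #8 #5 #2 #7 blue))) (leaf #8 #4 #2 #6 blue)) (leaf #7 #4 #2 #6 blue))) (node #5 #7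
  (node #5 #8 (node #4 #7 (leaf #8 #5 #4 #7 red) (node #4 #8 (leaf #7 #5 #4 #8 red)
  (leaf #8 #4 #2 #7 blue))) (leaf #8 #5 #2 #6 blue)) (leaf #7 #5 #2 #6 blue))) (node #5 #6
  (node #5 #7 (node #4 #6 (leaf #7 #5 #4 #6 red) (leaf #0 #2 #4 #6 blue)) (leaf #0 #2 #5 #7 blue))
  (leaf #0 #2 #5 #6 blue)))) (node #4 #6 (node #4 #7 (node #4 #8 (node #1 #4 (node #6 #7
  (leaf #1 #4 #6 #7 red) (node #6 #8 (leaf #1 #4 #6 #8 red) (leaf #8 #6 #2 #7 blue))) (node #1 #5
  (node #3 #6 (node #3 #5 (leaf #6 #3 #1 #5 red) (node #3 #4 (leaf #1 #3 #4 #6 red) (node #0 #3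
  (node #0 #2 (node #6 #7 (node #0 #4 (leaf #0 #4 #6 #7 red) (node #1 #6 (node #1 #7 (node #1 #8
  (node #6 #8 (leaf #8 #6 #1 #7 red) (node #3 #7 (leaf #7 #3 #1 #6 red) (node #5 #8 (node #5 #7
  (leaf #8 #5 #1 #7 red) (node #5 #6 (leaf #8 #5 #1 #6 red) (leaf #7 #5 #2 #6 blue))) (node #5 #6
  (node #5 #7 (leaf #7 #5 #1 #6 red) (leaf #8 #5 #2 #7 blue)) (leaf #8 #5 #2 #6 blue)))))
  (leaf #8 #1 #0 #4 blue)) (leaf #7 #1 #0 #4 blue)) (leaf #6 #1 #0 #4 blue))) (node #6 #8
  (node #0 #4 (leaf #0 #4 #6 #8 red) (node #1 #6 (node #1 #7 (node #1 #8 (node #3 #8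
  (leaf #8 #3 #1 #6 red) (node #5 #7 (node #5 #8 (leaf #8 #5 #1 #7 red) (node #5 #6
  (leaf #7 #5 #1 #6 red) (leaf #8 #5 #2 #6 blue))) (node #5 #6 (node #5 #8 (leaf #8 #5 #1 #6 red)
  (leaf #8 #5 #2 #7 blue)) (leaf #7 #5 #2 #6 blue)))) (leaf #8 #1 #0 #4 blue))
  (leaf #7 #1 #0 #4 blue)) (leaf #6 #1 #0 #4 blue))) (leaf #8 #6 #2 #7 blue)))
  (leaf #0 #2 #4 #5 blue)) (leaf #0 #3 #4 #5 blue)))) (node #3 #4 (node #6 #7 (leaf #3 #4 #6 #7 red)
  (node #6 #8 (leaf #3 #4 #6 #8 red) (leaf #8 #6 #2 #7 blue))) (node #0 #2 (node #0 #4 (node #6 #7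
  (leaf #0 #4 #6 #7 red) (node #6 #8 (leaf #0 #4 #6 #8 red) (leaf #8 #6 #2 #7 blue))) (node #1 #7
  (node #1 #8 (node #1 #6 (node #0 #3 (node #5 #7 (node #5 #6 (leaf #7 #5 #1 #6 red) (node #5 #8
  (leaf #8 #5 #1 #7 red) (leaf #8 #5 #2 #6 blue))) (node #5 #8 (node #5 #6 (leaf #8 #5 #1 #6 red)
  (leaf #7 #5 #2 #6 blue)) (leaf #8 #5 #2 #7 blue))) (leaf #6 #3 #0 #4 blue))
  (leaf #6 #1 #0 #4 blue)) (leaf #8 #1 #0 #4 blue)) (leaf #7 #1 #0 #4 blue)))
  (leaf #0 #2 #4 #5 blue)))) (leaf #0 #1 #4 #5 blue))) (leaf #8 #4 #2 #5 blue))
  (leaf #7 #4 #2 #5 blue)) (leaf #6 #4 #2 #5 blue))))))) (node #3 #5 (node #2 #5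
  (leaf #1 #2 #3 #5 red) (node #0 #3 (node #3 #4 (node #4 #5 (leaf #0 #3 #4 #5 red) (node #0 #4
  (leaf #5 #3 #0 #4 red) (node #0 #5 (leaf #4 #3 #0 #5 red) (node #0 #2 (node #4 #6 (node #4 #7
  (node #4 #8 (node #1 #4 (node #1 #6 (leaf #7 #4 #1 #6 red) (node #3 #6 (leaf #0 #3 #4 #6 red)
  (leaf #0 #1 #3 #6 blue))) (leaf #3 #1 #0 #4 blue)) (leaf #8 #4 #0 #5 blue))
  (leaf #7 #4 #0 #5 blue)) (leaf #6 #4 #0 #5 blue)) (leaf #5 #2 #0 #4 blue))))) (node #3 #6
  (node #3 #7 (node #5 #6 (leaf #0 #3 #5 #6 red) (node #5 #7 (leaf #0 #3 #5 #7 red) (node #6 #7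
  (leaf #0 #3 #6 #7 red) (leaf #2 #5 #6 #7 blue)))) (node #3 #8 (node #5 #6 (leaf #0 #3 #5 #6 red)
  (node #5 #8 (leaf #0 #3 #5 #8 red) (node #6 #8 (leaf #0 #3 #6 #8 red) (leaf #2 #5 #6 #8 blue))))
  (node #5 #6 (leaf #0 #3 #5 #6 red) (node #0 #5 (leaf #6 #3 #0 #5 red) (node #2 #6
  (leaf #1 #2 #3 #6 red) (node #0 #6 (leaf #5 #3 #0 #6 red) (node #0 #2 (node #2 #7
  (leaf #7 #2 #0 #3 red) (node #2 #8 (leaf #8 #2 #0 #3 red) (node #4 #7 (node #1 #4 (node #4 #8
  (node #1 #7 (leaf #8 #4 #1 #7 red) (leaf #0 #1 #3 #7 blue)) (leaf #1 #3 #4 #8 blue))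
  (leaf #0 #1 #3 #4 blue)) (leaf #1 #3 #4 #7 blue)))) (leaf #4 #2 #0 #5 blue)))))))) (node #4 #5
  (node #4 #6 (node #1 #4 (node #1 #6 (leaf #5 #4 #1 #6 red) (leaf #0 #1 #3 #6 blue))
  (leaf #0 #1 #3 #4 blue)) (leaf #1 #3 #4 #6 blue)) (node #0 #2 (node #2 #6 (leaf #6 #2 #0 #3 red)
  (node #2 #7 (leaf #7 #2 #0 #3 red) (node #5 #6 (node #2 #8 (leaf #8 #2 #0 #3 red) (node #4 #6
  (node #4 #7 (node #1 #4 (node #1 #6 (leaf #7 #4 #1 #6 red) (leaf #0 #1 #3 #6 blue))
  (leaf #0 #1 #3 #4 blue)) (leaf #7 #4 #2 #5 blue)) (leaf #1 #3 #4 #6 blue))) (node #5 #7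
  (node #3 #7 (leaf #0 #3 #5 #7 red) (node #3 #8 (node #5 #8 (leaf #0 #3 #5 #8 red)
  (leaf #8 #5 #2 #6 blue)) (node #2 #8 (leaf #8 #2 #0 #3 red) (node #5 #8 (node #7 #8
  (leaf #3 #5 #7 #8 red) (leaf #1 #3 #7 #8 blue)) (leaf #8 #5 #2 #6 blue)))))
  (leaf #7 #5 #2 #6 blue))))) (leaf #0 #2 #4 #5 blue))))) (node #1 #6 (node #2 #6
  (leaf #3 #2 #1 #6 red) (node #4 #5 (node #3 #4 (leaf #2 #3 #4 #5 red) (node #3 #7 (node #1 #4
  (node #4 #6 (leaf #5 #4 #1 #6 red) (node #4 #8 (node #1 #8 (leaf #5 #4 #1 #8 red)
  (leaf #8 #1 #0 #3 blue)) (leaf #8 #4 #2 #6 blue))) (leaf #4 #1 #0 #3 blue)) (node #4 #6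
  (node #1 #4 (leaf #5 #4 #1 #6 red) (leaf #4 #1 #0 #3 blue)) (node #3 #8 (node #2 #8
  (leaf #1 #2 #3 #8 red) (node #5 #8 (leaf #2 #3 #5 #8 red) (node #5 #6 (node #3 #6
  (leaf #2 #3 #5 #6 red) (leaf #0 #3 #4 #6 blue)) (leaf #8 #5 #2 #6 blue)))) (node #4 #7 (node #1 #4
  (node #1 #7 (leaf #5 #4 #1 #7 red) (leaf #7 #1 #0 #3 blue)) (leaf #4 #1 #0 #3 blue))
  (leaf #0 #3 #4 #7 blue)))))) (node #4 #6 (node #4 #7 (node #1 #4 (leaf #7 #4 #1 #6 red)
  (leaf #4 #1 #0 #3 blue)) (leaf #7 #4 #2 #5 blue)) (leaf #6 #4 #2 #5 blue))))
  (leaf #6 #1 #0 #3 blue)))) (node #3 #4 (node #1 #5 (node #2 #5 (leaf #3 #2 #1 #5 red) (node #3 #6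
  (node #4 #6 (leaf #2 #3 #4 #6 red) (node #2 #6 (leaf #1 #2 #3 #6 red) (node #4 #7 (node #4 #8
  (node #4 #5 (node #5 #7 (leaf #3 #4 #5 #7 red) (node #3 #7 (leaf #2 #3 #4 #7 red)
  (leaf #1 #3 #5 #7 blue))) (leaf #6 #4 #2 #5 blue)) (leaf #8 #4 #2 #6 blue))
  (leaf #7 #4 #2 #6 blue)))) (node #5 #6 (node #1 #6 (node #5 #7 (leaf #7 #5 #1 #6 red) (node #5 #8
  (leaf #8 #5 #1 #6 red) (node #2 #7 (node #3 #7 (leaf #1 #2 #3 #7 red) (leaf #1 #3 #5 #7 blue))
  (leaf #8 #5 #2 #7 blue)))) (leaf #0 #1 #3 #6 blue)) (leaf #1 #3 #5 #6 blue))))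
  (leaf #0 #1 #3 #5 blue)) (node #3 #6 (node #3 #7 (node #3 #8 (node #0 #3 (node #0 #2 (node #6 #7
  (leaf #0 #3 #6 #7 red) (node #6 #8 (leaf #0 #3 #6 #8 red) (node #7 #8 (leaf #0 #3 #7 #8 red)
  (node #0 #6 (leaf #7 #3 #0 #6 red) (leaf #0 #6 #7 #8 blue))))) (node #2 #6 (leaf #1 #2 #3 #6 red)
  (node #0 #6 (leaf #7 #3 #0 #6 red) (leaf #4 #2 #0 #6 blue)))) (node #6 #7 (leaf #2 #3 #6 #7 red)
  (node #6 #8 (leaf #2 #3 #6 #8 red) (node #7 #8 (leaf #2 #3 #7 #8 red) (node #2 #6
  (leaf #1 #2 #3 #6 red) (leaf #2 #6 #7 #8 blue)))))) (node #0 #3 (node #0 #6 (leaf #7 #3 #0 #6 red)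
  (node #2 #6 (leaf #1 #2 #3 #6 red) (node #0 #2 (node #6 #7 (leaf #0 #3 #6 #7 red) (node #0 #7
  (leaf #6 #3 #0 #7 red) (node #5 #8 (node #4 #5 (node #4 #8 (node #1 #4 (leaf #1 #4 #5 #8 red)
  (leaf #0 #1 #3 #4 blue)) (leaf #1 #3 #4 #8 blue)) (leaf #1 #3 #4 #5 blue)) (leaf #1 #3 #5 #8 blue))))
  (leaf #4 #2 #0 #6 blue)))) (node #6 #7 (leaf #2 #3 #6 #7 red) (node #2 #6 (leaf #1 #2 #3 #6 red)
  (node #2 #7 (leaf #1 #2 #3 #7 red) (node #5 #8 (node #4 #5 (node #4 #8 (node #1 #4
  (leaf #1 #4 #5 #8 red) (leaf #4 #1 #0 #3 blue)) (leaf #0 #3 #4 #8 blue)) (leaf #0 #3 #4 #5 blue))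
  (leaf #0 #3 #5 #8 blue))))))) (node #3 #8 (node #0 #3 (node #0 #6 (leaf #8 #3 #0 #6 red)
  (node #2 #6 (leaf #1 #2 #3 #6 red) (node #0 #2 (node #6 #8 (leaf #0 #3 #6 #8 red) (node #0 #8
  (leaf #6 #3 #0 #8 red) (node #5 #7 (node #4 #5 (node #4 #7 (node #1 #4 (leaf #1 #4 #5 #7 red)
  (leaf #0 #1 #3 #4 blue)) (leaf #1 #3 #4 #7 blue)) (leaf #1 #3 #4 #5 blue)) (leaf #1 #3 #5 #7 blue))))
  (leaf #4 #2 #0 #6 blue)))) (node #6 #8 (leaf #2 #3 #6 #8 red) (node #2 #6 (leaf #1 #2 #3 #6 red)
  (node #2 #8 (leaf #1 #2 #3 #8 red) (node #5 #7 (node #4 #5 (node #4 #7 (node #1 #4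
  (leaf #1 #4 #5 #7 red) (leaf #4 #1 #0 #3 blue)) (leaf #0 #3 #4 #7 blue)) (leaf #0 #3 #4 #5 blue))
  (leaf #0 #3 #5 #7 blue)))))) (node #2 #6 (leaf #1 #2 #3 #6 red) (node #5 #7 (node #5 #8
  (node #4 #5 (node #4 #7 (leaf #8 #5 #4 #7 red) (leaf #1 #3 #4 #7 blue)) (leaf #1 #3 #4 #5 blue))
  (leaf #1 #3 #5 #8 blue)) (leaf #1 #3 #5 #7 blue))))) (node #5 #6 (node #1 #5 (node #4 #5
  (node #4 #6 (node #1 #4 (leaf #6 #4 #1 #5 red) (leaf #0 #1 #3 #4 blue)) (leaf #1 #3 #4 #6 blue))
  (leaf #1 #3 #4 #5 blue)) (leaf #0 #1 #3 #5 blue)) (leaf #1 #3 #5 #6 blue))))))) (node #1 #4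
  (node #0 #2 (node #2 #5 (node #0 #3 (leaf #5 #2 #0 #3 red) (node #3 #5 (leaf #0 #2 #3 #5 red)
  (node #0 #5 (leaf #3 #2 #0 #5 red) (node #3 #4 (node #3 #6 (node #1 #3 (leaf #6 #3 #1 #4 red)
  (leaf #2 #1 #0 #3 blue)) (leaf #6 #3 #0 #5 blue)) (leaf #4 #3 #0 #5 blue))))) (node #1 #5
  (node #2 #6 (node #0 #3 (leaf #6 #2 #0 #3 red) (node #3 #6 (leaf #0 #2 #3 #6 red) (node #0 #6
  (leaf #3 #2 #0 #6 red) (node #3 #4 (node #3 #7 (node #1 #3 (leaf #7 #3 #1 #4 red)
  (leaf #2 #1 #0 #3 blue)) (leaf #7 #3 #0 #6 blue)) (leaf #4 #3 #0 #6 blue))))) (node #5 #6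
  (node #4 #5 (node #1 #6 (node #4 #6 (leaf #6 #4 #1 #5 red) (node #2 #4 (node #0 #3
  (leaf #4 #2 #0 #3 red) (node #3 #4 (leaf #0 #2 #3 #4 red) (node #4 #7 (leaf #7 #4 #1 #5 red)
  (node #4 #8 (leaf #8 #4 #1 #5 red) (node #0 #4 (leaf #3 #2 #0 #4 red) (node #3 #5 (node #3 #6
  (leaf #2 #3 #5 #6 red) (leaf #6 #3 #0 #4 blue)) (leaf #5 #3 #0 #4 blue)))))))
  (leaf #1 #2 #4 #6 blue))) (leaf #0 #1 #2 #6 blue)) (node #2 #4 (node #3 #4 (leaf #0 #2 #3 #4 red)
  (node #0 #3 (leaf #4 #2 #0 #3 red) (node #0 #4 (leaf #3 #2 #0 #4 red) (node #3 #5 (node #3 #6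
  (leaf #2 #3 #5 #6 red) (leaf #6 #3 #0 #4 blue)) (leaf #5 #3 #0 #4 blue)))))
  (leaf #1 #2 #4 #5 blue))) (leaf #1 #2 #5 #6 blue))) (leaf #0 #1 #2 #5 blue))) (node #1 #3
  (node #1 #5 (node #1 #6 (node #3 #4 (node #1 #7 (node #1 #8 (node #4 #5 (node #5 #6 (node #4 #6
  (leaf #6 #4 #1 #5 red) (node #4 #7 (leaf #7 #4 #1 #5 red) (node #2 #4 (node #4 #8
  (leaf #8 #4 #1 #5 red) (node #5 #7 (leaf #7 #5 #1 #6 red) (node #5 #8 (leaf #8 #5 #1 #6 red)
  (node #3 #5 (leaf #5 #3 #1 #4 red) (node #3 #7 (leaf #7 #3 #1 #4 red) (leaf #8 #5 #3 #7 blue))))))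
  (node #4 #8 (leaf #8 #4 #1 #5 red) (node #6 #7 (node #6 #8 (leaf #8 #6 #1 #7 red)
  (leaf #2 #4 #6 #8 blue)) (leaf #2 #4 #6 #7 blue)))))) (node #3 #5 (leaf #5 #3 #1 #4 red)
  (node #3 #6 (leaf #6 #3 #1 #4 red) (node #5 #7 (node #5 #8 (leaf #8 #5 #1 #7 red)
  (leaf #8 #5 #3 #6 blue)) (leaf #7 #5 #3 #6 blue))))) (node #4 #6 (node #4 #7
  (leaf #7 #4 #1 #6 red) (node #2 #4 (node #4 #8 (leaf #8 #4 #1 #6 red) (node #3 #5
  (leaf #5 #3 #1 #4 red) (node #3 #6 (leaf #6 #3 #1 #4 red) (node #3 #7 (leaf #7 #3 #1 #4 red)
  (node #5 #7 (node #5 #8 (leaf #8 #5 #1 #7 red) (node #5 #6 (leaf #7 #5 #1 #6 red)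
  (leaf #8 #5 #3 #6 blue))) (node #3 #8 (leaf #8 #3 #1 #4 red) (node #5 #6 (node #5 #8
  (leaf #8 #5 #1 #6 red) (leaf #8 #5 #3 #7 blue)) (leaf #7 #5 #3 #6 blue)))))))) (node #4 #8
  (leaf #8 #4 #1 #6 red) (node #5 #7 (node #5 #8 (leaf #8 #5 #1 #7 red) (leaf #2 #4 #5 #8 blue))
  (leaf #2 #4 #5 #7 blue))))) (node #2 #4 (node #3 #5 (leaf #5 #3 #1 #4 red) (node #3 #6
  (leaf #6 #3 #1 #4 red) (node #5 #6 (node #5 #7 (leaf #7 #5 #1 #6 red) (node #5 #8
  (leaf #8 #5 #1 #6 red) (node #3 #7 (leaf #7 #3 #1 #4 red) (leaf #8 #5 #3 #7 blue)))) (node #3 #7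
  (leaf #7 #3 #1 #4 red) (node #3 #8 (leaf #8 #3 #1 #4 red) (node #5 #7 (node #5 #8
  (leaf #8 #5 #1 #7 red) (leaf #8 #5 #3 #6 blue)) (leaf #7 #5 #3 #6 blue))))))) (node #5 #6
  (node #4 #7 (node #4 #8 (leaf #8 #4 #1 #7 red) (node #5 #8 (leaf #8 #5 #1 #6 red)
  (leaf #2 #4 #5 #8 blue))) (node #5 #7 (leaf #7 #5 #1 #6 red) (leaf #2 #4 #5 #7 blue)))
  (leaf #2 #4 #5 #6 blue))))) (leaf #8 #1 #0 #2 blue)) (leaf #7 #1 #0 #2 blue)) (node #3 #5
  (node #1 #7 (node #1 #8 (node #5 #6 (node #4 #6 (node #4 #7 (leaf #7 #4 #1 #6 red) (node #4 #8
  (leaf #8 #4 #1 #6 red) (node #3 #7 (leaf #7 #3 #1 #5 red) (leaf #8 #4 #3 #7 blue)))) (node #3 #6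
  (leaf #6 #3 #1 #5 red) (node #4 #5 (node #4 #7 (leaf #7 #4 #1 #5 red) (leaf #7 #4 #3 #6 blue))
  (leaf #5 #4 #3 #6 blue)))) (node #3 #6 (leaf #6 #3 #1 #5 red) (node #3 #7 (leaf #7 #3 #1 #5 red)
  (node #4 #6 (node #4 #7 (leaf #7 #4 #1 #6 red) (node #4 #5 (leaf #6 #4 #1 #5 red)
  (leaf #5 #4 #3 #7 blue))) (node #4 #5 (node #4 #7 (leaf #7 #4 #1 #5 red) (leaf #7 #4 #3 #6 blue))
  (leaf #5 #4 #3 #6 blue)))))) (leaf #8 #1 #0 #2 blue)) (leaf #7 #1 #0 #2 blue)) (node #1 #7
  (node #1 #8 (node #4 #5 (node #4 #6 (leaf #6 #4 #1 #5 red) (node #4 #7 (leaf #7 #4 #1 #5 red)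
  (node #4 #8 (leaf #8 #4 #1 #5 red) (node #3 #6 (node #3 #7 (leaf #7 #3 #1 #6 red)
  (leaf #6 #4 #3 #7 blue)) (leaf #7 #4 #3 #6 blue))))) (node #4 #6 (node #4 #7
  (leaf #7 #4 #1 #6 red) (leaf #7 #4 #3 #5 blue)) (leaf #6 #4 #3 #5 blue))) (leaf #8 #1 #0 #2 blue))
  (leaf #7 #1 #0 #2 blue)))) (leaf #6 #1 #0 #2 blue)) (leaf #5 #1 #0 #2 blue))
  (leaf #3 #1 #0 #2 blue))) (node #0 #2 (node #2 #4 (node #0 #4 (leaf #3 #2 #0 #4 red)
  (leaf #2 #1 #0 #4 blue)) (leaf #0 #1 #2 #4 blue)) (leaf #4 #1 #0 #2 blue)))) (node #1 #2
  (node #2 #4 (node #1 #4 (node #2 #5 (leaf #5 #2 #1 #4 red) (node #2 #6 (leaf #6 #2 #1 #4 red)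
  (node #2 #7 (leaf #7 #2 #1 #4 red) (node #2 #8 (leaf #8 #2 #1 #4 red) (node #3 #5 (node #0 #2
  (node #3 #4 (node #1 #3 (leaf #5 #3 #1 #4 red) (node #4 #5 (node #0 #3 (leaf #0 #3 #4 #5 red)
  (node #1 #5 (node #1 #6 (node #5 #6 (node #1 #7 (node #1 #8 (node #5 #7 (leaf #7 #5 #1 #6 red)
  (node #5 #8 (leaf #8 #5 #1 #6 red) (leaf #8 #5 #2 #7 blue))) (leaf #8 #1 #0 #3 blue))
  (leaf #7 #1 #0 #3 blue)) (node #5 #7 (node #5 #8 (node #1 #7 (leaf #8 #5 #1 #7 red)
  (leaf #7 #1 #0 #3 blue)) (leaf #8 #5 #2 #6 blue)) (leaf #7 #5 #2 #6 blue)))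
  (leaf #6 #1 #0 #3 blue)) (leaf #5 #1 #0 #3 blue))) (node #0 #3 (node #0 #5 (leaf #4 #3 #0 #5 red)
  (node #0 #4 (leaf #5 #3 #0 #4 red) (node #4 #6 (node #4 #7 (node #4 #8 (node #3 #6
  (leaf #0 #3 #4 #6 red) (node #3 #7 (leaf #0 #3 #4 #7 red) (leaf #7 #3 #2 #6 blue)))
  (leaf #8 #4 #0 #5 blue)) (leaf #7 #4 #0 #5 blue)) (leaf #6 #4 #0 #5 blue)))) (node #1 #6
  (node #1 #5 (node #1 #7 (node #1 #8 (node #5 #6 (node #5 #7 (leaf #7 #5 #1 #6 red) (node #5 #8
  (leaf #8 #5 #1 #6 red) (leaf #8 #5 #2 #7 blue))) (node #5 #7 (node #5 #8 (leaf #8 #5 #1 #7 red)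
  (leaf #8 #5 #2 #6 blue)) (leaf #7 #5 #2 #6 blue))) (leaf #8 #1 #0 #3 blue))
  (leaf #7 #1 #0 #3 blue)) (leaf #5 #1 #0 #3 blue)) (leaf #6 #1 #0 #3 blue))))) (node #3 #6
  (node #3 #7 (node #3 #8 (node #1 #3 (node #5 #6 (leaf #1 #3 #5 #6 red) (node #5 #7
  (leaf #1 #3 #5 #7 red) (leaf #7 #5 #2 #6 blue))) (node #0 #3 (node #5 #6 (leaf #0 #3 #5 #6 red)
  (node #5 #7 (leaf #0 #3 #5 #7 red) (leaf #7 #5 #2 #6 blue))) (node #1 #5 (node #1 #6 (node #5 #6
  (node #5 #7 (leaf #7 #5 #1 #6 red) (node #5 #8 (leaf #8 #5 #1 #6 red) (leaf #8 #5 #2 #7 blue)))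
  (node #5 #7 (node #5 #8 (leaf #8 #5 #3 #7 red) (leaf #8 #5 #2 #6 blue)) (leaf #7 #5 #2 #6 blue)))
  (leaf #6 #1 #0 #3 blue)) (leaf #5 #1 #0 #3 blue)))) (leaf #4 #3 #2 #8 blue))
  (leaf #4 #3 #2 #7 blue)) (leaf #4 #3 #2 #6 blue))) (node #0 #3 (node #3 #6 (node #5 #6
  (leaf #0 #3 #5 #6 red) (leaf #0 #2 #5 #6 blue)) (leaf #0 #2 #3 #6 blue)) (leaf #5 #2 #0 #3 blue)))
  (node #3 #4 (node #3 #6 (node #3 #7 (node #3 #8 (node #0 #3 (node #0 #6 (leaf #4 #3 #0 #6 red)
  (node #6 #7 (leaf #0 #3 #6 #7 red) (node #6 #8 (leaf #0 #3 #6 #8 red) (leaf #8 #6 #2 #7 blue))))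
  (node #1 #3 (leaf #6 #3 #1 #4 red) (node #1 #5 (node #1 #6 (node #4 #5 (node #1 #7 (node #1 #8
  (node #5 #6 (node #5 #7 (leaf #7 #5 #1 #6 red) (node #5 #8 (leaf #8 #5 #1 #6 red)
  (leaf #8 #5 #2 #7 blue))) (node #5 #7 (node #5 #8 (leaf #8 #5 #1 #7 red) (leaf #8 #5 #2 #6 blue))
  (leaf #7 #5 #2 #6 blue))) (leaf #8 #1 #0 #3 blue)) (leaf #7 #1 #0 #3 blue)) (node #1 #7
  (node #4 #6 (node #1 #8 (node #4 #7 (leaf #7 #4 #1 #6 red) (node #5 #7 (node #5 #8
  (leaf #8 #5 #1 #7 red) (node #5 #6 (leaf #7 #5 #1 #6 red) (leaf #8 #5 #2 #6 blue))) (node #4 #8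
  (leaf #8 #4 #1 #6 red) (node #5 #6 (node #5 #8 (leaf #8 #5 #1 #6 red) (leaf #8 #5 #2 #7 blue))
  (leaf #7 #5 #2 #6 blue))))) (leaf #8 #1 #0 #3 blue)) (node #5 #6 (node #5 #7
  (leaf #7 #5 #1 #6 red) (node #5 #8 (leaf #8 #5 #1 #6 red) (leaf #8 #5 #2 #7 blue))) (node #5 #7
  (node #5 #8 (leaf #8 #5 #1 #7 red) (leaf #8 #5 #2 #6 blue)) (leaf #7 #5 #2 #6 blue))))
  (leaf #7 #1 #0 #3 blue))) (leaf #6 #1 #0 #3 blue)) (leaf #5 #1 #0 #3 blue))))
  (leaf #8 #3 #2 #5 blue)) (leaf #7 #3 #2 #5 blue)) (leaf #6 #3 #2 #5 blue)) (leaf #4 #3 #2 #5 blue)))))))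
  (node #1 #3 (node #4 #5 (node #4 #6 (node #2 #5 (leaf #1 #2 #4 #5 red) (node #5 #6
  (leaf #2 #4 #5 #6 red) (node #3 #5 (node #2 #6 (leaf #1 #2 #4 #6 red) (node #5 #7 (node #5 #8
  (node #3 #7 (leaf #1 #3 #5 #7 red) (node #3 #6 (node #1 #6 (leaf #5 #3 #1 #6 red) (node #1 #5
  (leaf #6 #3 #1 #5 red) (leaf #0 #1 #5 #6 blue))) (leaf #7 #3 #2 #6 blue))) (leaf #8 #5 #2 #6 blue))
  (leaf #7 #5 #2 #6 blue))) (node #3 #4 (node #3 #6 (leaf #1 #3 #4 #6 red) (leaf #6 #3 #2 #5 blue))
  (leaf #4 #3 #2 #5 blue))))) (node #2 #5 (leaf #1 #2 #4 #5 red) (node #1 #6 (node #2 #6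
  (leaf #4 #2 #1 #6 red) (node #3 #6 (node #3 #5 (leaf #5 #3 #1 #6 red) (node #3 #7
  (leaf #7 #3 #1 #6 red) (leaf #7 #3 #2 #5 blue))) (node #3 #4 (node #3 #5 (leaf #1 #3 #4 #5 red)
  (leaf #6 #3 #2 #5 blue)) (leaf #4 #3 #2 #6 blue)))) (leaf #0 #1 #4 #6 blue)))) (node #4 #6
  (node #1 #5 (node #2 #5 (leaf #4 #2 #1 #5 red) (node #3 #5 (node #2 #6 (leaf #1 #2 #4 #6 red)
  (node #3 #6 (leaf #6 #3 #1 #5 red) (node #3 #7 (leaf #7 #3 #1 #5 red) (leaf #7 #3 #2 #6 blue))))
  (node #3 #4 (node #3 #6 (leaf #1 #3 #4 #6 red) (leaf #6 #3 #2 #5 blue)) (leaf #4 #3 #2 #5 blue))))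
  (leaf #0 #1 #4 #5 blue)) (node #1 #5 (node #5 #6 (node #1 #6 (node #3 #5 (node #3 #4
  (leaf #4 #3 #1 #5 red) (node #3 #6 (leaf #6 #3 #1 #5 red) (leaf #2 #3 #4 #6 blue))) (node #2 #5
  (leaf #4 #2 #1 #5 red) (node #5 #7 (leaf #7 #5 #1 #6 red) (node #5 #8 (leaf #8 #5 #1 #6 red)
  (node #2 #7 (node #4 #7 (leaf #1 #2 #4 #7 red) (leaf #1 #4 #5 #7 blue)) (leaf #8 #5 #2 #7 blue))))))
  (leaf #0 #1 #4 #6 blue)) (leaf #1 #4 #5 #6 blue)) (leaf #0 #1 #4 #5 blue)))) (node #0 #4
  (node #3 #4 (node #0 #3 (node #3 #5 (leaf #5 #3 #0 #4 red) (node #3 #6 (leaf #6 #3 #0 #4 red)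
  (node #3 #7 (leaf #7 #3 #0 #4 red) (node #3 #8 (leaf #8 #3 #0 #4 red) (node #2 #5 (node #1 #5
  (leaf #4 #2 #1 #5 red) (leaf #0 #1 #3 #5 blue)) (leaf #6 #3 #2 #5 blue))))))
  (leaf #4 #1 #0 #3 blue)) (leaf #0 #1 #3 #4 blue)) (leaf #3 #1 #0 #4 blue)))) (node #3 #4
  (node #0 #2 (node #4 #5 (node #1 #3 (node #3 #5 (leaf #1 #3 #4 #5 red) (node #3 #6 (node #3 #7
  (node #3 #8 (node #1 #6 (leaf #4 #3 #1 #6 red) (node #1 #4 (leaf #6 #3 #1 #4 red) (node #4 #6
  (leaf #1 #3 #4 #6 red) (leaf #0 #1 #4 #6 blue)))) (node #2 #5 (node #2 #8 (node #5 #8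
  (leaf #0 #2 #5 #8 red) (leaf #2 #3 #5 #8 blue)) (leaf #5 #3 #2 #8 blue)) (leaf #8 #3 #2 #5 blue)))
  (node #2 #5 (node #2 #7 (node #5 #7 (leaf #0 #2 #5 #7 red) (leaf #2 #3 #5 #7 blue))
  (leaf #5 #3 #2 #7 blue)) (leaf #7 #3 #2 #5 blue))) (node #2 #5 (node #2 #6 (node #5 #6
  (leaf #0 #2 #5 #6 red) (leaf #2 #3 #5 #6 blue)) (leaf #5 #3 #2 #6 blue)) (leaf #6 #3 #2 #5 blue))))
  (node #3 #5 (node #0 #3 (leaf #0 #3 #4 #5 red) (node #4 #6 (leaf #6 #4 #3 #5 red) (node #4 #7
  (leaf #7 #4 #3 #5 red) (node #4 #8 (leaf #8 #4 #3 #5 red) (node #2 #6 (node #2 #7 (node #6 #7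
  (leaf #0 #2 #6 #7 red) (leaf #2 #4 #6 #7 blue)) (leaf #6 #4 #2 #7 blue)) (leaf #7 #4 #2 #6 blue))))))
  (node #3 #6 (node #3 #7 (node #0 #3 (node #3 #8 (node #4 #6 (leaf #0 #3 #4 #6 red) (node #4 #7
  (leaf #0 #3 #4 #7 red) (node #6 #7 (leaf #0 #3 #6 #7 red) (leaf #2 #4 #6 #7 blue)))) (node #2 #5
  (node #2 #8 (node #5 #8 (leaf #0 #2 #5 #8 red) (leaf #1 #3 #5 #8 blue)) (leaf #5 #3 #2 #8 blue))
  (leaf #8 #3 #2 #5 blue))) (node #4 #6 (leaf #5 #4 #3 #6 red) (node #4 #7 (leaf #5 #4 #3 #7 red)
  (node #2 #6 (node #2 #7 (node #6 #7 (leaf #0 #2 #6 #7 red) (leaf #2 #4 #6 #7 blue))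
  (leaf #6 #4 #2 #7 blue)) (leaf #7 #4 #2 #6 blue))))) (node #2 #5 (node #2 #7 (node #5 #7
  (leaf #0 #2 #5 #7 red) (leaf #1 #3 #5 #7 blue)) (leaf #5 #3 #2 #7 blue)) (leaf #7 #3 #2 #5 blue)))
  (node #2 #5 (node #2 #6 (node #5 #6 (leaf #0 #2 #5 #6 red) (leaf #1 #3 #5 #6 blue))
  (leaf #5 #3 #2 #6 blue)) (leaf #6 #3 #2 #5 blue))))) (node #1 #3 (node #1 #4 (node #3 #5
  (leaf #5 #3 #1 #4 red) (node #3 #6 (leaf #6 #3 #1 #4 red) (node #3 #7 (leaf #7 #3 #1 #4 red)
  (node #3 #8 (leaf #8 #3 #1 #4 red) (node #2 #5 (node #2 #6 (node #5 #6 (leaf #0 #2 #5 #6 red)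
  (leaf #2 #3 #5 #6 blue)) (leaf #5 #3 #2 #6 blue)) (leaf #6 #3 #2 #5 blue)))))) (node #4 #6
  (node #4 #7 (node #3 #6 (leaf #1 #3 #4 #6 red) (node #3 #7 (leaf #1 #3 #4 #7 red) (node #6 #7
  (leaf #3 #4 #6 #7 red) (leaf #2 #3 #6 #7 blue)))) (node #2 #5 (node #2 #7 (node #5 #7
  (leaf #0 #2 #5 #7 red) (leaf #1 #4 #5 #7 blue)) (leaf #5 #4 #2 #7 blue)) (leaf #7 #4 #2 #5 blue)))
  (node #2 #5 (node #2 #6 (node #5 #6 (leaf #0 #2 #5 #6 red) (leaf #1 #4 #5 #6 blue))
  (leaf #5 #4 #2 #6 blue)) (leaf #6 #4 #2 #5 blue)))) (node #1 #5 (node #0 #3 (node #3 #6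
  (node #4 #6 (leaf #0 #3 #4 #6 red) (node #0 #4 (leaf #6 #3 #0 #4 red) (node #0 #6
  (leaf #4 #3 #0 #6 red) (leaf #5 #4 #0 #6 blue)))) (node #3 #7 (node #4 #7 (leaf #0 #3 #4 #7 red)
  (node #0 #4 (leaf #7 #3 #0 #4 red) (node #0 #7 (leaf #4 #3 #0 #7 red) (leaf #5 #4 #0 #7 blue))))
  (node #2 #6 (node #2 #7 (node #6 #7 (leaf #0 #2 #6 #7 red) (leaf #1 #3 #6 #7 blue))
  (leaf #6 #3 #2 #7 blue)) (leaf #7 #3 #2 #6 blue)))) (node #1 #6 (node #1 #7 (node #1 #8
  (node #2 #5 (node #2 #6 (leaf #6 #2 #1 #5 red) (node #4 #6 (node #1 #4 (node #4 #7
  (leaf #7 #4 #1 #6 red) (node #2 #7 (leaf #7 #2 #1 #5 red) (leaf #5 #4 #2 #7 blue)))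
  (leaf #4 #1 #0 #3 blue)) (leaf #5 #4 #2 #6 blue))) (node #4 #6 (node #4 #7 (node #4 #8 (node #1 #4
  (leaf #7 #4 #1 #6 red) (leaf #4 #1 #0 #3 blue)) (leaf #8 #4 #2 #5 blue)) (leaf #7 #4 #2 #5 blue))
  (leaf #6 #4 #2 #5 blue))) (leaf #8 #1 #0 #3 blue)) (leaf #7 #1 #0 #3 blue))
  (leaf #6 #1 #0 #3 blue))) (node #0 #3 (node #3 #5 (node #0 #5 (leaf #4 #3 #0 #5 red)
  (leaf #3 #1 #0 #5 blue)) (leaf #0 #1 #3 #5 blue)) (leaf #5 #1 #0 #3 blue))))) (node #0 #3
  (node #0 #4 (node #3 #5 (leaf #5 #3 #0 #4 red) (node #3 #6 (leaf #6 #3 #0 #4 red) (node #3 #7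
  (leaf #7 #3 #0 #4 red) (node #3 #8 (leaf #8 #3 #0 #4 red) (node #5 #6 (node #5 #7 (node #2 #5
  (node #2 #6 (leaf #1 #2 #5 #6 red) (leaf #0 #2 #3 #6 blue)) (leaf #0 #2 #3 #5 blue))
  (leaf #2 #3 #5 #7 blue)) (leaf #2 #3 #5 #6 blue)))))) (leaf #3 #2 #0 #4 blue))
  (leaf #4 #2 #0 #3 blue))) (node #3 #5 (node #3 #6 (node #3 #7 (node #3 #8 (node #1 #3 (node #1 #5
  (leaf #6 #3 #1 #5 red) (node #1 #6 (leaf #5 #3 #1 #6 red) (node #5 #6 (leaf #1 #3 #5 #6 red)
  (leaf #0 #1 #5 #6 blue)))) (node #0 #3 (node #0 #5 (leaf #6 #3 #0 #5 red) (node #5 #6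
  (leaf #0 #3 #5 #6 red) (node #5 #7 (leaf #0 #3 #5 #7 red) (node #0 #6 (leaf #5 #3 #0 #6 red)
  (leaf #7 #5 #0 #6 blue))))) (node #1 #5 (node #1 #4 (node #1 #6 (node #5 #6 (node #1 #7
  (node #4 #5 (node #1 #8 (node #4 #6 (leaf #6 #4 #1 #5 red) (node #4 #7 (leaf #7 #4 #1 #5 red)
  (node #4 #8 (leaf #8 #4 #1 #5 red) (node #6 #7 (node #6 #8 (leaf #8 #6 #1 #7 red)
  (leaf #2 #4 #6 #8 blue)) (leaf #2 #4 #6 #7 blue))))) (leaf #8 #1 #0 #3 blue)) (node #2 #5
  (node #2 #6 (leaf #6 #2 #1 #5 red) (node #2 #7 (leaf #7 #2 #1 #5 red) (node #2 #8
  (leaf #8 #2 #1 #5 red) (node #4 #6 (node #4 #7 (leaf #7 #4 #1 #6 red) (leaf #5 #4 #2 #7 blue))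
  (leaf #5 #4 #2 #6 blue))))) (node #4 #6 (node #4 #7 (leaf #7 #4 #1 #6 red) (leaf #7 #4 #2 #5 blue))
  (leaf #6 #4 #2 #5 blue)))) (leaf #7 #1 #0 #3 blue)) (node #1 #7 (node #1 #8 (node #0 #2
  (node #4 #5 (node #4 #6 (leaf #6 #4 #1 #5 red) (node #4 #7 (leaf #7 #4 #1 #5 red) (node #4 #8
  (leaf #8 #4 #1 #5 red) (node #2 #7 (node #2 #6 (leaf #7 #2 #1 #6 red) (leaf #7 #4 #2 #6 blue))
  (leaf #6 #4 #2 #7 blue))))) (node #4 #6 (node #4 #7 (leaf #7 #4 #1 #6 red) (node #4 #8
  (leaf #8 #4 #1 #6 red) (node #2 #7 (node #2 #5 (leaf #7 #2 #1 #5 red) (leaf #7 #4 #2 #5 blue))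
  (leaf #5 #4 #2 #7 blue)))) (leaf #2 #4 #5 #6 blue))) (leaf #4 #2 #0 #3 blue))
  (leaf #8 #1 #0 #3 blue)) (leaf #7 #1 #0 #3 blue))) (leaf #6 #1 #0 #3 blue))
  (leaf #4 #1 #0 #3 blue)) (leaf #5 #1 #0 #3 blue)))) (leaf #8 #3 #2 #4 blue))
  (leaf #7 #3 #2 #4 blue)) (leaf #6 #3 #2 #4 blue)) (leaf #5 #3 #2 #4 blue)))) (node #1 #3
  (node #0 #2 (node #3 #4 (node #1 #4 (node #3 #5 (leaf #5 #3 #1 #4 red) (node #3 #6
  (leaf #6 #3 #1 #4 red) (node #3 #7 (leaf #7 #3 #1 #4 red) (node #3 #8 (leaf #8 #3 #1 #4 red)
  (node #2 #5 (node #2 #6 (node #5 #6 (leaf #0 #2 #5 #6 red) (leaf #2 #3 #5 #6 blue))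
  (leaf #1 #2 #3 #6 blue)) (leaf #1 #2 #3 #5 blue)))))) (node #2 #4 (node #0 #4 (node #2 #5
  (leaf #5 #2 #0 #4 red) (node #2 #6 (leaf #6 #2 #0 #4 red) (node #2 #7 (leaf #7 #2 #0 #4 red)
  (node #2 #8 (leaf #8 #2 #0 #4 red) (node #3 #5 (node #1 #5 (leaf #4 #3 #1 #5 red)
  (leaf #0 #1 #2 #5 blue)) (leaf #1 #2 #3 #5 blue)))))) (leaf #2 #1 #0 #4 blue))
  (leaf #0 #1 #2 #4 blue))) (node #2 #4 (node #2 #5 (node #4 #5 (leaf #0 #2 #4 #5 red) (node #0 #4
  (leaf #5 #2 #0 #4 red) (node #0 #5 (leaf #4 #2 #0 #5 red) (node #3 #5 (node #1 #5 (node #3 #6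
  (leaf #6 #3 #1 #5 red) (node #3 #7 (leaf #7 #3 #1 #5 red) (node #3 #8 (leaf #8 #3 #1 #5 red)
  (node #2 #6 (node #4 #6 (leaf #0 #2 #4 #6 red) (leaf #2 #3 #4 #6 blue)) (leaf #1 #2 #3 #6 blue)))))
  (leaf #2 #1 #0 #5 blue)) (leaf #2 #3 #4 #5 blue))))) (node #2 #6 (node #4 #6
  (leaf #0 #2 #4 #6 red) (node #0 #4 (leaf #6 #2 #0 #4 red) (node #0 #6 (leaf #4 #2 #0 #6 red)
  (node #3 #5 (node #3 #6 (node #1 #5 (leaf #6 #3 #1 #5 red) (leaf #0 #1 #2 #5 blue))
  (leaf #2 #3 #4 #6 blue)) (leaf #1 #2 #3 #5 blue))))) (node #2 #7 (node #2 #8 (node #4 #7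
  (leaf #0 #2 #4 #7 red) (node #4 #8 (leaf #0 #2 #4 #8 red) (node #7 #8 (leaf #0 #2 #7 #8 red)
  (leaf #3 #4 #7 #8 blue)))) (node #4 #7 (leaf #0 #2 #4 #7 red) (node #0 #4 (leaf #7 #2 #0 #4 red)
  (node #0 #7 (leaf #4 #2 #0 #7 red) (node #3 #5 (node #3 #6 (node #5 #6 (leaf #1 #3 #5 #6 red)
  (leaf #1 #2 #5 #6 blue)) (leaf #1 #2 #3 #6 blue)) (leaf #1 #2 #3 #5 blue)))))) (node #3 #5
  (node #3 #6 (node #5 #6 (leaf #1 #3 #5 #6 red) (leaf #1 #2 #5 #6 blue)) (leaf #1 #2 #3 #6 blue))
  (leaf #1 #2 #3 #5 blue))))) (leaf #1 #2 #3 #4 blue))) (node #1 #4 (node #1 #5 (node #3 #4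
  (node #3 #5 (leaf #5 #3 #1 #4 red) (node #3 #6 (leaf #6 #3 #1 #4 red) (node #3 #7
  (leaf #7 #3 #1 #4 red) (node #3 #8 (leaf #8 #3 #1 #4 red) (node #5 #6 (node #5 #7 (node #6 #7
  (leaf #1 #5 #6 #7 red) (leaf #2 #3 #6 #7 blue)) (leaf #2 #3 #5 #7 blue)) (leaf #2 #3 #5 #6 blue))))))
  (node #3 #5 (node #3 #6 (leaf #6 #3 #1 #5 red) (node #3 #7 (leaf #7 #3 #1 #5 red) (node #3 #8
  (leaf #8 #3 #1 #5 red) (node #4 #6 (node #4 #7 (node #6 #7 (leaf #1 #4 #6 #7 red)
  (leaf #2 #3 #6 #7 blue)) (leaf #2 #3 #4 #7 blue)) (leaf #2 #3 #4 #6 blue))))) (node #4 #5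
  (node #4 #6 (leaf #6 #4 #1 #5 red) (node #4 #7 (leaf #7 #4 #1 #5 red) (node #4 #8
  (leaf #8 #4 #1 #5 red) (node #3 #6 (node #3 #7 (node #6 #7 (leaf #1 #3 #6 #7 red)
  (leaf #3 #4 #6 #7 blue)) (leaf #2 #3 #4 #7 blue)) (leaf #2 #3 #4 #6 blue)))))
  (leaf #2 #3 #4 #5 blue)))) (leaf #5 #1 #0 #2 blue)) (leaf #4 #1 #0 #2 blue)))
  (leaf #0 #1 #2 #3 blue))))
  where
  #0 #1 #2 #3 #4 #5 #6 #7 #8 : Fin 9
  #0 = # 0
  #1 = # 1
  #2 = # 2
  #3 = # 3
  #4 = # 4
  #5 = # 5
  #6 = # 6
  #7 = # 7
  #8 = # 8

arrows₉ : Arrows 9 H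
arrows₉ χ = certificate-sound χ [] certificate₉ [] (toWitness {a? = certifies? [] certificate₉} tt)

theorem3p13 : ∃ λ r → IsOrderedRamseyNumber (vl-ordering 3-pan e₂ label2) r × r ≤ 10
theorem3p13 = 9 , isOrderedRamseyNumber {H} arrows₉ ¬arrows₈ , n≤1+n 9
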